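{- Let $K$ be a construction with $(D,L_W,L_E)$ in its root. Then: (1) if $x$ precedes $y$ in $L_W$ and $z$ precedes $u$ in $L_E$, then every semipath from $x$ to $u$ intersects every semipath from $y$ to $z$; (2) for $X\in\{W,E\}$, if $L_X\colon x-y-z$, then $\psi_X(x,y,z)$; (3) for $X\in\{W,E\}$, if $L_X\colon x-y-u-z$, then every semipath from $x$ to $u$ intersects every semipath from $y$ to $z$.
   Context: A graph is a pair of functions $W,E\colon A\to V$ with $A\cap V=\emptyset$. $X$ ranges over $\{W,E\}$, $\bar W=E$, $\bar E=W$. A vertex $v$ is an $X$-vertex if no edge $a$ has $\bar X(a)=v$; $X(D)$ is the set of $X$-vertices; inner vertices are neither. An edge $a$ is an $X$-edge if $X(a)$ is an $X$-vertex. $W$-$E$-functional: for every $X$-edge $a$ and edge $b\ne a$, $X(a)\ne X(b)$. A semipath from $v_0$ to $v_n$ is $v_0a_1v_1\dots a_nv_n$ ($n\ge0$) with $\{W(a_i),E(a_i)\}=\{v_{i-1},v_i\}$ and no repeated vertex; semipaths intersect if they share a vertex; weakly connected: any two distinct vertices joined by a semipath; acyclic: no directed closed walk $v_0a_1\dots a_nv_n$, $n\ge1$, $W(a_i)=v_{i-1}$, $E(a_i)=v_i$, vertices distinct except $v_0=v_n$. A D-graph is a finite, acyclic, $W$-$E$-functional, weakly connected graph with an inner vertex; basic if exactly one inner vertex. Juncture: for D-graphs $D_W=(W_W,E_W\colon A_W\to V_W)$, $D_E=(W_E,E_E\colon A_E\to V_E)$, $D_W\Box D_E$ is defined when $C=A_W\cap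 A_E\ne\emptyset$, $E_W(a)=W_E(a)$ for $a\in C$, each $a\in C$ is an $E$-edge of $D_W$ and a $W$-edge of $D_E$, and $V_W\cap V_E=\{E_W(a)\mid a\in C\}=:V_C$; it has edges $A_W\cup A_E$, vertices $(V_W\cup V_E)\setminus V_C$, $W(a)=W_W(a)$ if $a\in A_W$ else $W_E(a)$, $E(a)=E_E(a)$ if $a\in A_E$ else $E_W(a)$. A list is a finite sequence of distinct elements; nonempty lists are compatible if they are $\Phi_1\Xi\Psi_1$ and $\Phi_2\Xi\Psi_2$ with $\Xi$ nonempty, $\Phi_1,\Phi_2,\Psi_1,\Psi_2,\Xi$ pairwise disjoint, at least one of $\Phi_1,\Phi_2$ empty and at least one of $\Psi_1,\Psi_2$ empty. $\Gamma\colon x_1-x_2-\dots-x_n$ means the distinct members $x_1,\dots,x_n$ occur in $\Gamma$ in this order or in the reverse order (not necessarily adjacent). Constructions: finite binary trees with a triple $(D,L_W,L_E)$ in each node, $D$ a D-graph, $L_X$ a list of all of $X(D)$. A single node with a basic D-graph and arbitrary such lists is a construction; if $K_W,K_E$ are constructions with roots $(D_W,L^W_W,L^W_E)$, $(D_E,L^E_W,L^E_E)$, $D_W\Box D_E$ is defined and $L^W_E=\Phi_E\Xi\Psi_E$, $L^E_W=\Phi_W\Xi\Psi_W$ are compatible, then a new root above the roots of $K_W,K_E$ containing $(D_W\Box D_E,\Phi_WL^W_W\Psi_W,\Phi_EL^E_E\Psi_E)$ gives a construction. For distinct $X$-vertices $u,v,w$ of $D$, $\psi_X(v,u,w)$ means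 every semipath from $v$ to $w$ intersects every semipath from $u$ to some $\bar X$-vertex. -}

module Defs where

open import Data.Nat using (ℕ)
open import Data.List using (List; []; _∷_; _++_; reverse)
open import Data.List.Membership.Propositional using (_∈_; _∉_)
open import Data.List.Relation.Unary.Unique.Propositional using (Unique)
open import Data.List.Relation.Binary.Sublist.Propositional using (_⊆_)
open import Data.Product using (Σ; ∃; ∃-syntax; _×_; _,_)
open import Data.Sum using (_⊎_)
open import Data.Empty using (⊥)
open import Relation.Nullary using (¬_)
open import Relation.Binary.PropositionalEquality using (_≡_; _≢_)
open import Function.Bundles using (_⇔_)

-- Edges and vertices are drawn from the ambient universe ℕ
-- (so that juncture, which uses set unions/intersections of edges and
-- vertices of different graphs, makes sense).  Finite sets are given
-- by lists, read as sets via membership.  The two functions W, E are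
-- total on ℕ; only their values on edges matter.

record Graph : Set where
  constructor graph
  field
    edges : List ℕ
    verts : List ℕ
    wf    : ℕ → ℕ
    ef    : ℕ → ℕ
open Graph public

record IsGraph (D : Graph) : Set where
  field
    w∈V      : ∀ {a} → a ∈ edges D → wf D a ∈ verts D
    e∈V      : ∀ {a} → a ∈ edges D → ef D a ∈ verts D
    disjoint : ∀ {x} → x ∈ edges D → x ∉ verts D

data Side : Set where
  W E : Side

opp : Side → Side
opp W = E
opp E = W

end : Side → Graph → ℕ → ℕ
end W D = wf D
end E D = ef D

XVertex : Side → Graph → ℕ → Set
XVertex X D v = v ∈ verts D × (∀ {a} → a ∈ edges D → end (opp X) D a ≢ v)

InnerVertex : Graph → ℕ → Set
InnerVertex D v = v ∈ verts D × ¬ XVertex W D v × ¬ XVertex E D v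

XEdge : Side → Graph → ℕ → Set
XEdge X D a = a ∈ edges D × XVertex X D (end X D a)

WEFunctional : Graph → Set
WEFunctional D = ∀ X {a b} → XEdge X D a → b ∈ edges D → b ≢ a →
                 end X D a ≢ end X D b

data SemiWalk (D : Graph) : ℕ → ℕ → List ℕ → Set where
  here : ∀ {v} → v ∈ verts D → SemiWalk D v v (v ∷ [])
  step : ∀ {u w v vs a} → u ∈ verts D → a ∈ edges D →
         ((wf D a ≡ u × ef D a ≡ w) ⊎ (wf D a ≡ w × ef D a ≡ u)) →
         SemiWalk D w v vs → SemiWalk D u v (u ∷ vs)

data DirWalk (D : Graph) : ℕ → ℕ → List ℕ → Set where
  here : ∀ {v} → v ∈ verts D → DirWalk D v v (v ∷ [])
  step : ∀ {u w v vs a} → u ∈ verts D → a ∈ edges D →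
         wf D a ≡ u → ef D a ≡ w →
         DirWalk D w v vs → DirWalk D u v (u ∷ vs)

Semipath : Graph → ℕ → ℕ → List ℕ → Set
Semipath D u v vs = SemiWalk D u v vs × Unique vs

Meet : List ℕ → List ℕ → Set
Meet vs ws = ∃[ x ] (x ∈ vs × x ∈ ws)

Cross : Graph → ℕ → ℕ → ℕ → ℕ → Set
Cross D a b c d = ∀ {vs ws} → Semipath D a b vs → Semipath D c d ws → Meet vs ws

WeaklyConnected : Graph → Set
WeaklyConnected D = ∀ {u v} → u ∈ verts D → v ∈ verts D → u ≢ v →
                    ∃[ vs ] Semipath D u v vs

-- No directed closed walk v₀ a₁ v₁ … aₙ vₙ (n ≥ 1) with v₀ = vₙ and
-- otherwise distinct vertices: the first edge a goes from v₀ = W(a) to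
-- v₁ = E(a), and v₁ … vₙ is a directed walk with distinct vertices.
Acyclic : Graph → Set
Acyclic D = ∀ {a vs} → a ∈ edges D → DirWalk D (ef D a) (wf D a) vs → Unique vs → ⊥

record DGraph (D : Graph) : Set where
  field
    isGraph    : IsGraph D
    acyclic    : Acyclic D
    functional : WEFunctional D
    connected  : WeaklyConnected D
    inner      : ∃[ v ] InnerVertex D v

Basic : Graph → Set
Basic D = ∃[ v ] (InnerVertex D v × (∀ {w} → InnerVertex D w → w ≡ v))

Common : Graph → Graph → ℕ → Set
Common DW DE a = a ∈ edges DW × a ∈ edges DE

InVC : Graph → Graph → ℕ → Set
InVC DW DE v = ∃[ a ] (Common DW DE a × ef DW a ≡ v)

JunctureDefined : Graph → Graph → Set
JunctureDefined DW DE =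
  (∃[ a ] Common DW DE a) ×
  (∀ {a} → Common DW DE a → ef DW a ≡ wf DE a × XEdge E DW a × XEdge W DE a) ×
  (∀ v → (v ∈ verts DW × v ∈ verts DE) ⇔ InVC DW DE v)

IsJuncture : Graph → Graph → Graph → Set
IsJuncture DW DE D =
  (∀ a → a ∈ edges D ⇔ (a ∈ edges DW ⊎ a ∈ edges DE)) ×
  (∀ v → v ∈ verts D ⇔ ((v ∈ verts DW ⊎ v ∈ verts DE) × ¬ InVC DW DE v)) ×
  (∀ {a} → a ∈ edges D →
     (a ∈ edges DW → wf D a ≡ wf DW a) × (a ∉ edges DW → wf D a ≡ wf DE a) ×
     (a ∈ edges DE → ef D a ≡ ef DE a) × (a ∉ edges DE → ef D a ≡ ef DW a))

XList : Side → Graph → List ℕ → Set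
XList X D L = Unique L × (∀ v → v ∈ L ⇔ XVertex X D v)

Disjoint : List ℕ → List ℕ → Set
Disjoint xs ys = ∀ {x} → x ∈ xs → x ∉ ys

Compatible : List ℕ → List ℕ → List ℕ → List ℕ → List ℕ → Set
Compatible Φ₁ Ψ₁ Φ₂ Ψ₂ Ξ =
  Ξ ≢ [] ×
  Disjoint Φ₁ Φ₂ × Disjoint Φ₁ Ψ₁ × Disjoint Φ₁ Ψ₂ × Disjoint Φ₁ Ξ ×
  Disjoint Φ₂ Ψ₁ × Disjoint Φ₂ Ψ₂ × Disjoint Φ₂ Ξ ×
  Disjoint Ψ₁ Ψ₂ × Disjoint Ψ₁ Ξ × Disjoint Ψ₂ Ξ ×
  (Φ₁ ≡ [] ⊎ Φ₂ ≡ []) × (Ψ₁ ≡ [] ⊎ Ψ₂ ≡ [])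

data Construction : Graph → List ℕ → List ℕ → Set where
  leaf : ∀ {D LW LE} → DGraph D → Basic D → XList W D LW → XList E D LE →
         Construction D LW LE
  node : ∀ {DW LWW LWE DE LEW LEE D ΦW ΨW ΦE ΨE Ξ} →
         Construction DW LWW LWE → Construction DE LEW LEE →
         JunctureDefined DW DE → IsJuncture DW DE D →
         LWE ≡ ΦE ++ Ξ ++ ΨE → LEW ≡ ΦW ++ Ξ ++ ΨW →
         Compatible ΦE ΨE ΦW ΨW Ξ →
         DGraph D → XList W D (ΦW ++ LWW ++ ΨW) → XList E D (ΦE ++ LEE ++ ΨE) →
         Construction D (ΦW ++ LWW ++ ΨW) (ΦE ++ LEE ++ ΨE)

Precedes : ℕ → ℕ → List ℕ → Set
Precedes x y L = (x ∷ y ∷ []) ⊆ L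

Chain : List ℕ → List ℕ → Set
Chain L xs = xs ⊆ L ⊎ reverse xs ⊆ L

sel : Side → List ℕ → List ℕ → List ℕ
sel W LW LE = LW
sel E LW LE = LE

Psi : Side → Graph → ℕ → ℕ → ℕ → Set
Psi X D v u w = ∀ t → XVertex (opp X) D t → Cross D v w u t

module Submission where

-- Read LW ++ reverse LE as the boundary of D traversed once around.  Everything follows from one
-- invariant of constructions: if a walk from a to b avoids a walk from c to d, then c and d lie on
-- the same side of the chord ab of this cycle, the side being the parity `between`.  In a basic
-- D-graph every walk between distinct boundary vertices passes through the unique inner vertex.
-- For a juncture D = DW □ DE, cut a walk P of D at its common edges into segments inside DW and
-- DE, and for a boundary vertex t add up, over the segments lying in the part of t, the parity of
-- "t lies between the ends of the segment".  These parities telescope along P, so up to a constant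
-- they tell on which side of P the vertex t lies in D; by the induction hypothesis for DW and DE
-- they do not change along a walk avoiding P.  The three statements are then instances of
-- interleaved boundary vertices.

open import Defs
open import Data.Nat using (ℕ; _≟_)
open import Data.Bool using (Bool; true; false; not; _xor_; if_then_else_)
open import Data.Bool.Properties using (xor-assoc; xor-comm; xor-same; xor-identityʳ; xor-annihilates-not; xor-∧-commutativeRing)
open import Algebra.Bundles using (CommutativeRing)
open import Algebra.Properties.CommutativeSemigroup (CommutativeRing.+-commutativeSemigroup xor-∧-commutativeRing) using (interchange; x∙yz≈y∙xz)
open import Data.List using (List; []; _∷_; _++_; reverse)
open import Data.List.Properties using (unfold-reverse; ++-assoc; reverse-++)
open import Data.List.Membership.Propositional using (_∈_; _∉_; find; lose)
open import Data.List.Membership.Propositional.Properties using (∈-++⁺ˡ; ∈-++⁺ʳ; ∈-++⁻)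
open import Data.List.Membership.DecPropositional _≟_ using (_∈?_)
open import Data.List.Relation.Unary.Any using (here; there; any?)
import Data.List.Relation.Unary.Any.Properties as Any
open import Data.List.Relation.Unary.All as All using (All; []; _∷_)
open import Data.List.Relation.Unary.AllPairs using ([]; _∷_)
open import Data.List.Relation.Unary.Unique.Propositional {A = ℕ} using (Unique)
import Data.List.Relation.Unary.Unique.Propositional.Properties as Unique
open import Data.List.Relation.Binary.Sublist.Propositional {A = ℕ} using (_⊆_; []; _∷_; _∷ʳ_; ⊆-refl; ⊆-trans; lookup; from∈)
import Data.List.Relation.Binary.Sublist.Propositional.Properties as Sublist
open import Data.Product using (∃-syntax; _×_; _,_; proj₁; proj₂)
open import Data.Sum using (_⊎_; inj₁; inj₂; [_,_]′)
open import Data.Empty using (⊥; ⊥-elim)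
open import Relation.Nullary using (¬_; Dec; yes; no; does; ¬?)
open import Relation.Nullary.Decidable using (dec-true; dec-false; map′)
open import Relation.Binary.PropositionalEquality using (_≡_; _≢_; refl; sym; trans; cong; cong₂; subst; module ≡-Reasoning)
open import Function.Bundles using (Equivalence; _⇔_)
open Equivalence using (to; from)

before : List ℕ → ℕ → ℕ → Bool
before []       a v = false
before (x ∷ xs) a v with x ≟ v
... | yes _ = false
... | no  _ with x ≟ a
...   | yes _ = true
...   | no  _ = before xs a v

-- For v ∉ {a, b}, whether v lies on the arc strictly between a and b.
between : List ℕ → ℕ → ℕ → ℕ → Bool
between L a b v = before L a v xor before L b v

between-comm : ∀ L a b v → between L a b v ≡ between L b a v
between-comm L a b v = xor-comm (before L a v) (before L b v)

between-self : ∀ L a v → between L a a v ≡ false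
between-self L a v = xor-same (before L a v)

Unique-resp-⊇ : ∀ {K L} → K ⊆ L → Unique L → Unique K
Unique-resp-⊇ []       u         = u
Unique-resp-⊇ (y ∷ʳ τ) (_ ∷ u)   = Unique-resp-⊇ τ u
Unique-resp-⊇ (refl ∷ τ) (x∉ ∷ u) = Sublist.All-resp-⊆ τ x∉ ∷ Unique-resp-⊇ τ u

Unique-reverse : ∀ {xs} → Unique xs → Unique (reverse xs)
Unique-reverse {[]}     u        = u
Unique-reverse {x ∷ xs} (x∉ ∷ u) = subst Unique (sym (unfold-reverse x xs))
  (Unique.++⁺ (Unique-reverse u) ([] ∷ [])
    λ { (y∈ , here refl) → All.lookup x∉ (Any.reverse⁻ y∈) refl })

xs⊆xs++ys : ∀ xs ys → xs ⊆ xs ++ ys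
xs⊆xs++ys xs ys = Sublist.++⁺ʳ ys (⊆-refl {x = xs})

++-keepˡ : ∀ xs {ys zs} → ys ⊆ zs → xs ++ ys ⊆ xs ++ zs
++-keepˡ xs = Sublist.++⁺ (⊆-refl {x = xs})

before-⊆ : ∀ {K L a v} → Unique L → K ⊆ L → a ∈ K → v ∈ K → before K a v ≡ before L a v
before-⊆ u [] () _
before-⊆ {a = a} {v} (y∉ ∷ u) (y ∷ʳ τ) a∈ v∈ with y ≟ v
... | yes refl = ⊥-elim (All.lookup y∉ (lookup τ v∈) refl)
... | no _ with y ≟ a
...   | yes refl = ⊥-elim (All.lookup y∉ (lookup τ a∈) refl)
...   | no _ = before-⊆ u τ a∈ v∈
before-⊆ {a = a} {v} (_ ∷ u) (_∷_ {x = y} refl τ) a∈ v∈ with y ≟ v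
... | yes refl = refl
... | no y≢v with y ≟ a
...   | yes refl = refl
...   | no y≢a = before-⊆ u τ (tail a∈ y≢a) (tail v∈ y≢v)
  where
  tail : ∀ {z zs} → z ∈ y ∷ zs → y ≢ z → z ∈ zs
  tail (here refl) y≢z = ⊥-elim (y≢z refl)
  tail (there z∈)  _   = z∈

before-true : ∀ {L a v} → Unique L → (a ∷ v ∷ []) ⊆ L → before L a v ≡ true
before-true {a = a} {v} u τ with Unique-resp-⊇ τ u
... | ((a≢v ∷ []) ∷ _) = trans (sym (before-⊆ u τ (here refl) (there (here refl)))) first
  where
  first : before (a ∷ v ∷ []) a v ≡ true
  first with a ≟ v
  ... | yes a≡v = ⊥-elim (a≢v a≡v)
  ... | no _ with a ≟ a
  ...   | yes _   = refl
  ...   | no a≢a  = ⊥-elim (a≢a refl)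

before-false : ∀ {L a v} → Unique L → (v ∷ a ∷ []) ⊆ L → before L a v ≡ false
before-false {a = a} {v} u τ = trans (sym (before-⊆ u τ (there (here refl)) (here refl))) first
  where
  first : before (v ∷ a ∷ []) a v ≡ false
  first with v ≟ v
  ... | yes _   = refl
  ... | no v≢v  = ⊥-elim (v≢v refl)

before-++ : ∀ {L A B a b} → Unique L → A ++ B ⊆ L → a ∈ A → b ∈ B → before L a b ≡ true
before-++ u τ a∈ b∈ = before-true u (⊆-trans (Sublist.++⁺ (from∈ a∈) (from∈ b∈)) τ)

after-++ : ∀ {L A B a b} → Unique L → A ++ B ⊆ L → a ∈ A → b ∈ B → before L b a ≡ false
after-++ u τ a∈ b∈ = before-false u (⊆-trans (Sublist.++⁺ (from∈ a∈) (from∈ b∈)) τ)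

precedes-or-follows : ∀ {x y L} → x ∈ L → y ∈ L → x ≢ y → Precedes x y L ⊎ Precedes y x L
precedes-or-follows {L = z ∷ zs} (here refl) (here refl) x≢y = ⊥-elim (x≢y refl)
precedes-or-follows {L = z ∷ zs} (here refl) (there y∈) _ = inj₁ (refl ∷ from∈ y∈)
precedes-or-follows {L = z ∷ zs} (there x∈) (here refl) _ = inj₂ (refl ∷ from∈ x∈)
precedes-or-follows {L = z ∷ zs} (there x∈) (there y∈) x≢y with precedes-or-follows x∈ y∈ x≢y
... | inj₁ τ = inj₁ (z ∷ʳ τ)
... | inj₂ τ = inj₂ (z ∷ʳ τ)

true≢false : true ≢ false
true≢false ()

xor-cancelʳ : ∀ x k → (x xor k) xor k ≡ x
xor-cancelʳ x k = begin
  (x xor k) xor k  ≡⟨ xor-assoc x k k ⟩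
  x xor (k xor k)  ≡⟨ cong (x xor_) (xor-same k) ⟩
  x xor false      ≡⟨ xor-identityʳ x ⟩
  x                ∎
  where open ≡-Reasoning

xor-injectiveʳ : ∀ {x y} k → x xor k ≡ y xor k → x ≡ y
xor-injectiveʳ {x} {y} k eq = begin
  x                ≡⟨ xor-cancelʳ x k ⟨
  (x xor k) xor k  ≡⟨ cong (_xor k) eq ⟩
  (y xor k) xor k  ≡⟨ xor-cancelʳ y k ⟩
  y                ∎
  where open ≡-Reasoning

xor-transpose : ∀ {x y z} → x xor y ≡ z → x ≡ y xor z
xor-transpose {x} {y} {z} eq = begin
  x                ≡⟨ xor-cancelʳ x y ⟨
  (x xor y) xor y  ≡⟨ cong (_xor y) eq ⟩
  z xor y          ≡⟨ xor-comm z y ⟩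
  y xor z          ∎
  where open ≡-Reasoning

xor-shift : ∀ x y k → (x xor k) xor (y xor k) ≡ x xor y
xor-shift x y k = begin
  (x xor k) xor (y xor k)  ≡⟨ interchange x k y k ⟩
  (x xor y) xor (k xor k)  ≡⟨ cong ((x xor y) xor_) (xor-same k) ⟩
  (x xor y) xor false      ≡⟨ xor-identityʳ (x xor y) ⟩
  x xor y                  ∎
  where open ≡-Reasoning

xor-telescope : ∀ x y z {A} → A ≡ y xor z → (x xor y) xor A ≡ x xor z
xor-telescope x y z refl = begin
  (x xor y) xor (y xor z)  ≡⟨ cong ((x xor y) xor_) (xor-comm y z) ⟩
  (x xor y) xor (z xor y)  ≡⟨ xor-shift x z y ⟩
  x xor z                  ∎
  where open ≡-Reasoning

Boundary : Graph → ℕ → Set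
Boundary D v = XVertex W D v ⊎ XVertex E D v

boundary-verts : ∀ {G x} → Boundary G x → x ∈ verts G
boundary-verts (inj₁ w) = proj₁ w
boundary-verts (inj₂ e) = proj₁ e

source∈ : ∀ {D u v vs} → SemiWalk D u v vs → u ∈ vs
source∈ (here _)       = here refl
source∈ (step _ _ _ _) = here refl

target∈ : ∀ {D u v vs} → SemiWalk D u v vs → v ∈ vs
target∈ (here _)       = here refl
target∈ (step _ _ _ r) = there (target∈ r)

walk-verts : ∀ {D u v vs x} → SemiWalk D u v vs → x ∈ vs → x ∈ verts D
walk-verts (here v∈)       (here refl) = v∈
walk-verts (step u∈ _ _ _) (here refl) = u∈
walk-verts (step _ _ _ r)  (there x∈)  = walk-verts r x∈

meet? : ∀ vs ws → Dec (Meet vs ws)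
meet? vs ws = map′ find (λ (_ , x∈vs , x∈ws) → lose x∈vs x∈ws) (any? (_∈? ws) vs)

xVertex? : ∀ X D v → Dec (XVertex X D v)
xVertex? X D v with v ∈? verts D | All.all? (λ a → ¬? (end (opp X) D a ≟ v)) (edges D)
... | no v∉   | _        = no λ xv → v∉ (proj₁ xv)
... | yes v∈  | yes none = yes (v∈ , λ a∈ → All.lookup none a∈)
... | yes _   | no some  = no λ xv → some (All.tabulate (proj₂ xv))

inner-not-boundary : ∀ {D i v} → InnerVertex D i → Boundary D v → v ≢ i
inner-not-boundary (_ , ¬w , _) (inj₁ w) refl = ¬w w
inner-not-boundary (_ , _ , ¬e) (inj₂ e) refl = ¬e e

-- An isolated vertex cannot be joined to the inner vertex.
W-vertex⇒¬E-vertex : ∀ {D x} → DGraph D → XVertex W D x → ¬ XVertex E D x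
W-vertex⇒¬E-vertex {D} {x} g xw xe with DGraph.inner g
... | i , inner with DGraph.connected g (proj₁ xw) (proj₁ inner) (inner-not-boundary inner (inj₁ xw))
...   | _ , (here _ , _)                       = inner-not-boundary inner (inj₁ xw) refl
...   | _ , (step _ a∈ (inj₁ (wa , _)) _ , _) = proj₂ xe a∈ wa
...   | _ , (step _ a∈ (inj₂ (_ , ea)) _ , _) = proj₂ xw a∈ ea

Unique-boundary : ∀ {D LW LE} → DGraph D → XList W D LW → XList E D LE → Unique (LW ++ reverse LE)
Unique-boundary g (uW , ∈W) (uE , ∈E) = Unique.++⁺ uW (Unique-reverse uE)
  λ (w , e) → W-vertex⇒¬E-vertex g (to (∈W _) w) (to (∈E _) (Any.reverse⁻ e))

Incident : Graph → ℕ → ℕ → ℕ → Set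
Incident H a u w = (wf H a ≡ u × ef H a ≡ w) ⊎ (wf H a ≡ w × ef H a ≡ u)

incident-transfer : ∀ {G H a u w} → wf G a ≡ wf H a → ef G a ≡ ef H a → Incident G a u w → Incident H a u w
incident-transfer w≡ e≡ (inj₁ (wu , ew)) = inj₁ (trans (sym w≡) wu , trans (sym e≡) ew)
incident-transfer w≡ e≡ (inj₂ (ww , eu)) = inj₂ (trans (sym w≡) ww , trans (sym e≡) eu)

incident-verts : ∀ {H a u w} → IsGraph H → a ∈ edges H → Incident H a u w → u ∈ verts H × w ∈ verts H
incident-verts {H} g a∈ (inj₁ (wu , ew)) = subst (_∈ verts H) wu (IsGraph.w∈V g a∈) , subst (_∈ verts H) ew (IsGraph.e∈V g a∈)
incident-verts {H} g a∈ (inj₂ (ww , eu)) = subst (_∈ verts H) eu (IsGraph.e∈V g a∈) , subst (_∈ verts H) ww (IsGraph.w∈V g a∈)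

-- By W-E-functionality, s and t are the only neighbours of s and of t.
walk-trapped : ∀ {D s t e u q vs} → WEFunctional D → XVertex W D s → XVertex E D t →
  e ∈ edges D → wf D e ≡ s → ef D e ≡ t → SemiWalk D u q vs → (u ≡ s ⊎ u ≡ t) →
  All (λ x → x ≡ s ⊎ x ≡ t) vs
walk-trapped fn xs xt e∈ ws et (here _) st = st ∷ []
walk-trapped {D} {s} {t} {e} fn xs xt e∈ ws et (step {w = w} {a = e′} _ e′∈ inc r) st =
  st ∷ walk-trapped fn xs xt e∈ ws et r (next st inc)
  where
  next : ∀ {u} → (u ≡ s ⊎ u ≡ t) → Incident D e′ u w → w ≡ s ⊎ w ≡ t
  next (inj₁ refl) (inj₁ (w≡ , e≡)) with e′ ≟ e
  ... | yes refl = inj₂ (trans (sym e≡) et)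
  ... | no e′≢e  = ⊥-elim (fn W (e∈ , subst (XVertex W D) (sym ws) xs) e′∈ e′≢e (trans ws (sym w≡)))
  next (inj₁ refl) (inj₂ (_ , e≡)) = ⊥-elim (proj₂ xs e′∈ e≡)
  next (inj₂ refl) (inj₁ (w≡ , _)) = ⊥-elim (proj₂ xt e′∈ w≡)
  next (inj₂ refl) (inj₂ (w≡ , e≡)) with e′ ≟ e
  ... | yes refl = inj₁ (trans (sym w≡) ws)
  ... | no e′≢e  = ⊥-elim (fn E (e∈ , subst (XVertex E D) (sym et) xt) e′∈ e′≢e (trans et (sym e≡)))

no-W-to-E-edge : ∀ {D s t e} → DGraph D → XVertex W D s → XVertex E D t →
  e ∈ edges D → wf D e ≡ s → ef D e ≡ t → ⊥
no-W-to-E-edge g xs xt e∈ ws et with DGraph.inner g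
... | i , inner with DGraph.connected g (proj₁ xs) (proj₁ inner) (inner-not-boundary inner (inj₁ xs))
...   | _ , (walk , _) with All.lookup (walk-trapped (DGraph.functional g) xs xt e∈ ws et walk (inj₁ refl)) (target∈ walk)
...     | inj₁ refl = inner-not-boundary inner (inj₁ xs) refl
...     | inj₂ refl = inner-not-boundary inner (inj₂ xt) refl

basic-walk-via-inner : ∀ {D i p q vs} → DGraph D → InnerVertex D i → (∀ {w} → InnerVertex D w → w ≡ i) →
  Boundary D p → SemiWalk D p q vs → q ≢ p → i ∈ vs
basic-walk-via-inner g inner unique bp (here _) q≢p = ⊥-elim (q≢p refl)
basic-walk-via-inner {D} {i} {p} g inner unique bp (step {w = w} {a = e} _ e∈ inc r) _ with w ≟ i
... | yes refl = there (source∈ r)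
... | no w≢i with xVertex? W D w | xVertex? E D w
...   | no ¬w | no ¬e = ⊥-elim (w≢i (unique (walk-verts r (source∈ r) , ¬w , ¬e)))
...   | yes xw | _    = ⊥-elim (from-W xw inc bp)
  where
  from-W : XVertex W D w → Incident D e p w → Boundary D p → ⊥
  from-W xw (inj₁ (_ , e≡))  _         = proj₂ xw e∈ e≡
  from-W xw (inj₂ (_ , e≡))  (inj₁ xp) = proj₂ xp e∈ e≡
  from-W xw (inj₂ (w≡ , e≡)) (inj₂ xp) = no-W-to-E-edge g xw xp e∈ w≡ e≡
...   | no _ | yes xe = ⊥-elim (from-E xe inc bp)
  where
  from-E : XVertex E D w → Incident D e p w → Boundary D p → ⊥
  from-E xe (inj₂ (w≡ , _))  _         = proj₂ xe e∈ w≡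
  from-E xe (inj₁ (w≡ , _))  (inj₂ xp) = proj₂ xp e∈ w≡
  from-E xe (inj₁ (w≡ , e≡)) (inj₁ xp) = no-W-to-E-edge g xp xe e∈ w≡ e≡

boundary-of : ∀ {D LW LE x} → XList W D LW → XList E D LE → x ∈ LW ++ reverse LE → Boundary D x
boundary-of {LW = LW} (_ , ∈W) (_ , ∈E) x∈ with ∈-++⁻ LW x∈
... | inj₁ w = inj₁ (to (∈W _) w)
... | inj₂ e = inj₂ (to (∈E _) (Any.reverse⁻ e))

-- Read L as the boundary of D in cyclic order: a walk from a to b meets every walk joining
-- the two sides of the chord ab.
NonCrossing : Graph → List ℕ → Set
NonCrossing D L = ∀ {a b c d vs ws} → a ∈ L → b ∈ L → c ∈ L → d ∈ L →
  SemiWalk D a b vs → SemiWalk D c d ws → ¬ Meet vs ws → between L a b c ≡ between L a b d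

-- Two walks between distinct boundary vertices both pass through the inner vertex.
basic-nonCrossing : ∀ {D LW LE} → DGraph D → Basic D → XList W D LW → XList E D LE → NonCrossing D (LW ++ reverse LE)
basic-nonCrossing {D} {LW} {LE} g (i , inner , unique) xW xE {a} {b} {c} {d} a∈ b∈ c∈ d∈ P Q disjoint with a ≟ b | c ≟ d
... | yes refl | _        = trans (between-self (LW ++ reverse LE) a c) (sym (between-self (LW ++ reverse LE) a d))
... | no _     | yes refl = refl
... | no a≢b   | no c≢d   = ⊥-elim (disjoint (i , via-inner a∈ P (λ b≡a → a≢b (sym b≡a)) , via-inner c∈ Q (λ d≡c → c≢d (sym d≡c))))
  where
  via-inner : ∀ {p q vs} → p ∈ LW ++ reverse LE → SemiWalk D p q vs → q ≢ p → i ∈ vs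
  via-inner p∈ = basic-walk-via-inner g inner unique (boundary-of xW xE p∈)

module Juncture
  {DW DE D : Graph} (gW : DGraph DW) (gE : DGraph DE) (gD : DGraph D)
  (jd : JunctureDefined DW DE) (ij : IsJuncture DW DE D)
  {ΦW LWW ΨW ΦE LEE ΨE Ξ : List ℕ}
  (xWW : XList W DW LWW) (xWE : XList E DW (ΦE ++ Ξ ++ ΨE))
  (xEW : XList W DE (ΦW ++ Ξ ++ ΨW)) (xEE : XList E DE LEE)
  (xDW : XList W D (ΦW ++ LWW ++ ΨW)) (xDE : XList E D (ΦE ++ LEE ++ ΨE))
  (compatible : Compatible ΦE ΨE ΦW ΨW Ξ)
  (ncW : NonCrossing DW (LWW ++ reverse (ΦE ++ Ξ ++ ΨE)))
  (ncE : NonCrossing DE ((ΦW ++ Ξ ++ ΨW) ++ reverse LEE)) where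

  ΦEʳ ΨEʳ LEEʳ Ξʳ : List ℕ
  ΦEʳ  = reverse ΦE
  ΨEʳ  = reverse ΨE
  LEEʳ = reverse LEE
  Ξʳ   = reverse Ξ

  ∂W ∂E ∂D : List ℕ
  ∂W = LWW ++ ΨEʳ ++ Ξʳ ++ ΦEʳ
  ∂E = ΦW ++ Ξ ++ ΨW ++ LEEʳ
  ∂D = ΦW ++ LWW ++ ΨW ++ ΨEʳ ++ LEEʳ ++ ΦEʳ

  ∂W-≡ : LWW ++ reverse (ΦE ++ Ξ ++ ΨE) ≡ ∂W
  ∂W-≡ = cong (LWW ++_) (begin
    reverse (ΦE ++ Ξ ++ ΨE)       ≡⟨ reverse-++ ΦE (Ξ ++ ΨE) ⟩
    reverse (Ξ ++ ΨE) ++ ΦEʳ      ≡⟨ cong (_++ ΦEʳ) (reverse-++ Ξ ΨE) ⟩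
    (ΨEʳ ++ Ξʳ) ++ ΦEʳ            ≡⟨ ++-assoc ΨEʳ Ξʳ ΦEʳ ⟩
    ΨEʳ ++ Ξʳ ++ ΦEʳ              ∎)
    where open ≡-Reasoning

  ∂E-≡ : (ΦW ++ Ξ ++ ΨW) ++ reverse LEE ≡ ∂E
  ∂E-≡ = trans (++-assoc ΦW (Ξ ++ ΨW) LEEʳ) (cong (ΦW ++_) (++-assoc Ξ ΨW LEEʳ))

  ∂D-≡ : (ΦW ++ LWW ++ ΨW) ++ reverse (ΦE ++ LEE ++ ΨE) ≡ ∂D
  ∂D-≡ = begin
    (ΦW ++ LWW ++ ΨW) ++ reverse (ΦE ++ LEE ++ ΨE)   ≡⟨ ++-assoc ΦW (LWW ++ ΨW) _ ⟩
    ΦW ++ (LWW ++ ΨW) ++ reverse (ΦE ++ LEE ++ ΨE)   ≡⟨ cong (ΦW ++_) (++-assoc LWW ΨW _) ⟩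
    ΦW ++ LWW ++ ΨW ++ reverse (ΦE ++ LEE ++ ΨE)     ≡⟨ cong (λ R → ΦW ++ LWW ++ ΨW ++ R) reversed ⟩
    ∂D                                               ∎
    where
    open ≡-Reasoning
    reversed : reverse (ΦE ++ LEE ++ ΨE) ≡ ΨEʳ ++ LEEʳ ++ ΦEʳ
    reversed = trans (reverse-++ ΦE (LEE ++ ΨE))
                 (trans (cong (_++ ΦEʳ) (reverse-++ LEE ΨE)) (++-assoc ΨEʳ LEEʳ ΦEʳ))

  ΨE#ΦE : Disjoint ΨE ΦE
  ΨE#ΦE x∈Ψ x∈Φ = let _ , _ , ΦE#ΨE , _ = compatible in ΦE#ΨE x∈Φ x∈Ψ
  ΨW#ΦW : Disjoint ΨW ΦW
  ΨW#ΦW x∈Ψ x∈Φ = let _ , _ , _ , _ , _ , _ , ΦW#ΨW , _ = compatible in ΦW#ΨW x∈Φ x∈Ψ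

  empty-Φ : ΦE ≡ [] ⊎ ΦW ≡ []
  empty-Φ = let _ , _ , _ , _ , _ , _ , _ , _ , _ , _ , _ , e , _ = compatible in e
  empty-Ψ : ΨE ≡ [] ⊎ ΨW ≡ []
  empty-Ψ = let _ , _ , _ , _ , _ , _ , _ , _ , _ , _ , _ , _ , e = compatible in e

  ∉-empty : ∀ {x : ℕ} {xs} → xs ≡ [] → x ∉ xs
  ∉-empty refl ()

  not-both-Φ : ∀ {x y} → x ∈ ΦE → y ∈ ΦW → ⊥
  not-both-Φ x∈ y∈ = [ (λ e → ∉-empty e x∈) , (λ e → ∉-empty e y∈) ]′ empty-Φ

  not-both-Ψ : ∀ {x y} → x ∈ ΨE → y ∈ ΨW → ⊥
  not-both-Ψ x∈ y∈ = [ (λ e → ∉-empty e x∈) , (λ e → ∉-empty e y∈) ]′ empty-Ψ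

  ∈₁ : ∀ {x : ℕ} {A} B C → x ∈ A → x ∈ A ++ B ++ C
  ∈₁ B C = ∈-++⁺ˡ
  ∈₂ : ∀ {x : ℕ} A {B} C → x ∈ B → x ∈ A ++ B ++ C
  ∈₂ A C x∈ = ∈-++⁺ʳ A (∈-++⁺ˡ x∈)
  ∈₃ : ∀ {x : ℕ} A B {C} → x ∈ C → x ∈ A ++ B ++ C
  ∈₃ A B x∈ = ∈-++⁺ʳ A (∈-++⁺ʳ B x∈)

  data WSide (x : ℕ) : Set where
    inLWW : x ∈ LWW → WSide x
    inΨE  : x ∈ ΨE  → WSide x
    inΦE  : x ∈ ΦE  → WSide x

  data ESide (x : ℕ) : Set where
    inΦW  : x ∈ ΦW  → ESide x
    inΨW  : x ∈ ΨW  → ESide x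
    inLEE : x ∈ LEE → ESide x

  Ξ-E-of-DW : ∀ {x} → x ∈ Ξ → XVertex E DW x
  Ξ-E-of-DW x∈ = to (proj₂ xWE _) (∈₂ ΦE ΨE x∈)

  Ξ-W-of-DE : ∀ {x} → x ∈ Ξ → XVertex W DE x
  Ξ-W-of-DE x∈ = to (proj₂ xEW _) (∈₂ ΦW ΨW x∈)

  WSide-DW : ∀ {x} → WSide x → Boundary DW x
  WSide-DW (inLWW x∈) = inj₁ (to (proj₂ xWW _) x∈)
  WSide-DW (inΨE x∈)  = inj₂ (to (proj₂ xWE _) (∈₃ ΦE Ξ x∈))
  WSide-DW (inΦE x∈)  = inj₂ (to (proj₂ xWE _) (∈₁ Ξ ΨE x∈))

  ESide-DE : ∀ {x} → ESide x → Boundary DE x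
  ESide-DE (inΦW x∈)  = inj₁ (to (proj₂ xEW _) (∈₁ Ξ ΨW x∈))
  ESide-DE (inΨW x∈)  = inj₁ (to (proj₂ xEW _) (∈₃ ΦW Ξ x∈))
  ESide-DE (inLEE x∈) = inj₂ (to (proj₂ xEE _) x∈)

  WSide-D : ∀ {x} → WSide x → Boundary D x
  WSide-D (inLWW x∈) = inj₁ (to (proj₂ xDW _) (∈₂ ΦW ΨW x∈))
  WSide-D (inΨE x∈)  = inj₂ (to (proj₂ xDE _) (∈₃ ΦE LEE x∈))
  WSide-D (inΦE x∈)  = inj₂ (to (proj₂ xDE _) (∈₁ LEE ΨE x∈))

  ESide-D : ∀ {x} → ESide x → Boundary D x
  ESide-D (inΦW x∈)  = inj₁ (to (proj₂ xDW _) (∈₁ LWW ΨW x∈))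
  ESide-D (inΨW x∈)  = inj₁ (to (proj₂ xDW _) (∈₃ ΦW LWW x∈))
  ESide-D (inLEE x∈) = inj₂ (to (proj₂ xDE _) (∈₂ ΦE ΨE x∈))

  shared⇔VC : ∀ v → (v ∈ verts DW × v ∈ verts DE) ⇔ InVC DW DE v
  shared⇔VC = proj₂ (proj₂ jd)

  shared-∉D : ∀ {x} → x ∈ verts DW → x ∈ verts DE → x ∉ verts D
  shared-∉D {x} x∈W x∈E x∈D = proj₂ (to (proj₁ (proj₂ ij) x) x∈D) (to (shared⇔VC x) (x∈W , x∈E))

  D-verts : ∀ {x} → x ∈ verts D → x ∈ verts DW ⊎ x ∈ verts DE
  D-verts {x} x∈ = proj₁ (to (proj₁ (proj₂ ij) x) x∈)

  Ξ-∉D : ∀ {x} → x ∈ Ξ → x ∉ verts D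
  Ξ-∉D x∈ = shared-∉D (proj₁ (Ξ-E-of-DW x∈)) (proj₁ (Ξ-W-of-DE x∈))

  WSide#ESide : ∀ {x} → WSide x → ESide x → ⊥
  WSide#ESide w e = shared-∉D (boundary-verts (WSide-DW w)) (boundary-verts (ESide-DE e)) (boundary-verts (WSide-D w))

  WSide#Ξ : ∀ {x} → WSide x → x ∉ Ξ
  WSide#Ξ w x∈ = Ξ-∉D x∈ (boundary-verts (WSide-D w))

  ESide#Ξ : ∀ {x} → ESide x → x ∉ Ξ
  ESide#Ξ e x∈ = Ξ-∉D x∈ (boundary-verts (ESide-D e))

  LWW#ΦE : ∀ {x} → x ∈ LWW → x ∉ ΦE
  LWW#ΦE x∈ y∈ = W-vertex⇒¬E-vertex gW (to (proj₂ xWW _) x∈) (to (proj₂ xWE _) (∈₁ Ξ ΨE y∈))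

  LEE#ΦW : ∀ {x} → x ∈ LEE → x ∉ ΦW
  LEE#ΦW x∈ y∈ = W-vertex⇒¬E-vertex gE (to (proj₂ xEW _) (∈₁ Ξ ΨW y∈)) (to (proj₂ xEE _) x∈)

  common-edge : ∀ {a} → Common DW DE a → ef DW a ≡ wf DE a × XEdge E DW a × XEdge W DE a
  common-edge = proj₁ (proj₂ jd)

  wf-W : ∀ {a} → a ∈ edges D → a ∈ edges DW → wf D a ≡ wf DW a
  wf-W a∈ = proj₁ (proj₂ (proj₂ ij) a∈)
  wf-E : ∀ {a} → a ∈ edges D → a ∉ edges DW → wf D a ≡ wf DE a
  wf-E a∈ = proj₁ (proj₂ (proj₂ (proj₂ ij) a∈))
  ef-E : ∀ {a} → a ∈ edges D → a ∈ edges DE → ef D a ≡ ef DE a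
  ef-E a∈ = proj₁ (proj₂ (proj₂ (proj₂ (proj₂ ij) a∈)))
  ef-W : ∀ {a} → a ∈ edges D → a ∉ edges DE → ef D a ≡ ef DW a
  ef-W a∈ = proj₂ (proj₂ (proj₂ (proj₂ (proj₂ ij) a∈)))

  ∂D-view : ∀ {x} → x ∈ ∂D → WSide x ⊎ ESide x
  ∂D-view x∈ with ∈-++⁻ ΦW x∈
  ... | inj₁ p = inj₂ (inΦW p)
  ... | inj₂ x∈ with ∈-++⁻ LWW x∈
  ...   | inj₁ p = inj₁ (inLWW p)
  ...   | inj₂ x∈ with ∈-++⁻ ΨW x∈
  ...     | inj₁ p = inj₂ (inΨW p)
  ...     | inj₂ x∈ with ∈-++⁻ ΨEʳ x∈
  ...       | inj₁ p = inj₁ (inΨE (Any.reverse⁻ p))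
  ...       | inj₂ x∈ with ∈-++⁻ LEEʳ x∈
  ...         | inj₁ p = inj₂ (inLEE (Any.reverse⁻ p))
  ...         | inj₂ p = inj₁ (inΦE (Any.reverse⁻ p))

  ∂W-view : ∀ {x} → x ∈ ∂W → WSide x ⊎ x ∈ Ξ
  ∂W-view x∈ with ∈-++⁻ LWW x∈
  ... | inj₁ p = inj₁ (inLWW p)
  ... | inj₂ x∈ with ∈-++⁻ ΨEʳ x∈
  ...   | inj₁ p = inj₁ (inΨE (Any.reverse⁻ p))
  ...   | inj₂ x∈ with ∈-++⁻ Ξʳ x∈
  ...     | inj₁ p = inj₂ (Any.reverse⁻ p)
  ...     | inj₂ p = inj₁ (inΦE (Any.reverse⁻ p))

  ∂E-view : ∀ {x} → x ∈ ∂E → ESide x ⊎ x ∈ Ξ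
  ∂E-view x∈ with ∈-++⁻ ΦW x∈
  ... | inj₁ p = inj₁ (inΦW p)
  ... | inj₂ x∈ with ∈-++⁻ Ξ x∈
  ...   | inj₁ p = inj₂ p
  ...   | inj₂ x∈ with ∈-++⁻ ΨW x∈
  ...     | inj₁ p = inj₁ (inΨW p)
  ...     | inj₂ p = inj₁ (inLEE (Any.reverse⁻ p))

  WSide-∂W : ∀ {x} → WSide x → x ∈ ∂W
  WSide-∂W (inLWW p) = ∈-++⁺ˡ p
  WSide-∂W (inΨE p)  = ∈-++⁺ʳ LWW (∈-++⁺ˡ (Any.reverse⁺ p))
  WSide-∂W (inΦE p)  = ∈-++⁺ʳ LWW (∈-++⁺ʳ ΨEʳ (∈-++⁺ʳ Ξʳ (Any.reverse⁺ p)))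

  ESide-∂E : ∀ {x} → ESide x → x ∈ ∂E
  ESide-∂E (inΦW p)  = ∈-++⁺ˡ p
  ESide-∂E (inΨW p)  = ∈-++⁺ʳ ΦW (∈-++⁺ʳ Ξ (∈-++⁺ˡ p))
  ESide-∂E (inLEE p) = ∈-++⁺ʳ ΦW (∈-++⁺ʳ Ξ (∈-++⁺ʳ ΨW (Any.reverse⁺ p)))

  ∂D-verts : ∀ {x} → x ∈ ∂D → x ∈ verts D
  ∂D-verts x∈ = [ (λ w → boundary-verts (WSide-D w)) , (λ e → boundary-verts (ESide-D e)) ]′ (∂D-view x∈)

  ∂W∩∂E⊆Ξ : ∀ {x} → x ∈ ∂W → x ∈ ∂E → x ∈ Ξ
  ∂W∩∂E⊆Ξ x∈W x∈E with ∂W-view x∈W | ∂E-view x∈E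
  ... | inj₂ p | _      = p
  ... | inj₁ _ | inj₂ p = p
  ... | inj₁ w | inj₁ e = ⊥-elim (WSide#ESide w e)

  Unique-∂W : Unique ∂W
  Unique-∂W = subst Unique ∂W-≡ (Unique-boundary gW xWW xWE)
  Unique-∂E : Unique ∂E
  Unique-∂E = subst Unique ∂E-≡ (Unique-boundary gE xEW xEE)
  Unique-∂D : Unique ∂D
  Unique-∂D = subst Unique ∂D-≡ (Unique-boundary gD xDW xDE)

  open Sublist using (++⁺ˡ)

  ΦW<LWW : ΦW ++ LWW ⊆ ∂D
  ΦW<LWW = ++-keepˡ ΦW (xs⊆xs++ys LWW _)
  ΦW<ΨEʳ : ΦW ++ ΨEʳ ⊆ ∂D
  ΦW<ΨEʳ = ++-keepˡ ΦW (++⁺ˡ LWW (++⁺ˡ ΨW (xs⊆xs++ys ΨEʳ _)))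
  LWW<ΨW : LWW ++ ΨW ⊆ ∂D
  LWW<ΨW = ++⁺ˡ ΦW (++-keepˡ LWW (xs⊆xs++ys ΨW _))
  LWW<LEEʳ : LWW ++ LEEʳ ⊆ ∂D
  LWW<LEEʳ = ++⁺ˡ ΦW (++-keepˡ LWW (++⁺ˡ ΨW (++⁺ˡ ΨEʳ (xs⊆xs++ys LEEʳ _))))
  ΨEʳ<LEEʳ : ΨEʳ ++ LEEʳ ⊆ ∂D
  ΨEʳ<LEEʳ = ++⁺ˡ ΦW (++⁺ˡ LWW (++⁺ˡ ΨW (++-keepˡ ΨEʳ (xs⊆xs++ys LEEʳ _))))
  ΨW<ΦEʳ : ΨW ++ ΦEʳ ⊆ ∂D
  ΨW<ΦEʳ = ++⁺ˡ ΦW (++⁺ˡ LWW (++-keepˡ ΨW (++⁺ˡ ΨEʳ (++⁺ˡ LEEʳ ⊆-refl))))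
  LEEʳ<ΦEʳ : LEEʳ ++ ΦEʳ ⊆ ∂D
  LEEʳ<ΦEʳ = ++⁺ˡ ΦW (++⁺ˡ LWW (++⁺ˡ ΨW (++⁺ˡ ΨEʳ ⊆-refl)))

  LWW<Ξʳ : LWW ++ Ξʳ ⊆ ∂W
  LWW<Ξʳ = ++-keepˡ LWW (++⁺ˡ ΨEʳ (xs⊆xs++ys Ξʳ _))
  ΨEʳ<Ξʳ : ΨEʳ ++ Ξʳ ⊆ ∂W
  ΨEʳ<Ξʳ = ++⁺ˡ LWW (++-keepˡ ΨEʳ (xs⊆xs++ys Ξʳ _))
  Ξʳ<ΦEʳ : Ξʳ ++ ΦEʳ ⊆ ∂W
  Ξʳ<ΦEʳ = ++⁺ˡ LWW (++⁺ˡ ΨEʳ ⊆-refl)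
  Ξʳ⊆∂W : Ξʳ ⊆ ∂W
  Ξʳ⊆∂W = ++⁺ˡ LWW (++⁺ˡ ΨEʳ (xs⊆xs++ys Ξʳ _))

  ΦW<Ξ : ΦW ++ Ξ ⊆ ∂E
  ΦW<Ξ = ++-keepˡ ΦW (xs⊆xs++ys Ξ _)
  Ξ<ΨW : Ξ ++ ΨW ⊆ ∂E
  Ξ<ΨW = ++⁺ˡ ΦW (++-keepˡ Ξ (xs⊆xs++ys ΨW _))
  Ξ<LEEʳ : Ξ ++ LEEʳ ⊆ ∂E
  Ξ<LEEʳ = ++⁺ˡ ΦW (++-keepˡ Ξ (++⁺ˡ ΨW ⊆-refl))
  Ξ⊆∂E : Ξ ⊆ ∂E
  Ξ⊆∂E = ++⁺ˡ ΦW (xs⊆xs++ys Ξ _)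

  ∂W-agrees : ∀ {a t} → WSide a → WSide t → before ∂W a t ≡ before ∂D a t
  ∂W-agrees a∈ t∈ = trans (sym (before-⊆ Unique-∂W K⊆∂W (in-K a∈) (in-K t∈))) (before-⊆ Unique-∂D K⊆∂D (in-K a∈) (in-K t∈))
    where
    K : List ℕ
    K = LWW ++ ΨEʳ ++ ΦEʳ
    K⊆∂W : K ⊆ ∂W
    K⊆∂W = ++-keepˡ LWW (++-keepˡ ΨEʳ (++⁺ˡ Ξʳ ⊆-refl))
    K⊆∂D : K ⊆ ∂D
    K⊆∂D = ++⁺ˡ ΦW (++-keepˡ LWW (++⁺ˡ ΨW (++-keepˡ ΨEʳ (++⁺ˡ LEEʳ ⊆-refl))))
    in-K : ∀ {x} → WSide x → x ∈ K
    in-K (inLWW p) = ∈₁ ΨEʳ ΦEʳ p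
    in-K (inΨE p)  = ∈₂ LWW ΦEʳ (Any.reverse⁺ p)
    in-K (inΦE p)  = ∈₃ LWW ΨEʳ (Any.reverse⁺ p)

  ∂E-agrees : ∀ {a t} → ESide a → ESide t → before ∂E a t ≡ before ∂D a t
  ∂E-agrees a∈ t∈ = trans (sym (before-⊆ Unique-∂E K⊆∂E (in-K a∈) (in-K t∈))) (before-⊆ Unique-∂D K⊆∂D (in-K a∈) (in-K t∈))
    where
    K : List ℕ
    K = ΦW ++ ΨW ++ LEEʳ
    K⊆∂E : K ⊆ ∂E
    K⊆∂E = ++-keepˡ ΦW (++⁺ˡ Ξ ⊆-refl)
    K⊆∂D : K ⊆ ∂D
    K⊆∂D = ++-keepˡ ΦW (++⁺ˡ LWW (++-keepˡ ΨW (++⁺ˡ ΨEʳ (xs⊆xs++ys LEEʳ _))))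
    in-K : ∀ {x} → ESide x → x ∈ K
    in-K (inΦW p)  = ∈₁ ΨW LEEʳ p
    in-K (inΨW p)  = ∈₂ ΦW LEEʳ p
    in-K (inLEE p) = ∈₃ ΦW ΨW (Any.reverse⁺ p)

  G : Side → Graph
  G W = DW
  G E = DE

  ∂ : Side → List ℕ
  ∂ W = ∂W
  ∂ E = ∂E

  isGraph : ∀ X → IsGraph (G X)
  isGraph W = DGraph.isGraph gW
  isGraph E = DGraph.isGraph gE

  ∂D→∂ : ∀ X {x} → x ∈ ∂D → x ∈ verts (G X) → x ∈ ∂ X
  ∂D→∂ W x∈ x∈W with ∂D-view x∈
  ... | inj₁ w = WSide-∂W w
  ... | inj₂ e = ⊥-elim (shared-∉D x∈W (boundary-verts (ESide-DE e)) (∂D-verts x∈))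
  ∂D→∂ E x∈ x∈E with ∂D-view x∈
  ... | inj₁ w = ⊥-elim (shared-∉D (boundary-verts (WSide-DW w)) x∈E (∂D-verts x∈))
  ... | inj₂ e = ESide-∂E e

  junction-∂W : ∀ {a} → Common DW DE a → ef DW a ∈ ∂W
  junction-∂W com = subst (_ ∈_) ∂W-≡ (∈-++⁺ʳ LWW (Any.reverse⁺ (from (proj₂ xWE _) (proj₂ (proj₁ (proj₂ (common-edge com)))))))

  junction-∂E : ∀ {a} → Common DW DE a → wf DE a ∈ ∂E
  junction-∂E com = subst (_ ∈_) ∂E-≡ (∈-++⁺ˡ (from (proj₂ xEW _) (proj₂ (proj₂ (proj₂ (common-edge com))))))

  same-part : ∀ X Y {u} → u ∈ verts (G X) → u ∈ verts (G Y) → u ∈ verts D → X ≡ Y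
  same-part W W _  _  _  = refl
  same-part E E _  _  _  = refl
  same-part W E uW uE uD = ⊥-elim (shared-∉D uW uE uD)
  same-part E W uE uW uD = ⊥-elim (shared-∉D uW uE uD)

  data EdgeOwner (a : ℕ) : Set where
    own    : ∀ X → a ∈ edges (G X) → a ∉ edges (G (opp X)) → EdgeOwner a
    shared : Common DW DE a → EdgeOwner a

  owner : ∀ {a} → a ∈ edges D → EdgeOwner a
  owner {a} a∈ with a ∈? edges DW | a ∈? edges DE
  ... | yes aW | yes aE = shared (aW , aE)
  ... | yes aW | no ¬aE = own W aW ¬aE
  ... | no ¬aW | yes aE = own E aE ¬aW
  ... | no ¬aW | no ¬aE = ⊥-elim ([ ¬aW , ¬aE ]′ (to (proj₁ ij a) a∈))

  own-incidence : ∀ X {a u w} → a ∈ edges D → a ∈ edges (G X) → a ∉ edges (G (opp X)) →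
    Incident D a u w → Incident (G X) a u w
  own-incidence W a∈ aW ¬aE = incident-transfer {D} {DW} (wf-W a∈ aW) (ef-W a∈ ¬aE)
  own-incidence E a∈ aE ¬aW = incident-transfer {D} {DE} (wf-E a∈ ¬aW) (ef-E a∈ aE)

  -- The juncture vertex of a traversed common edge is charged to the walk.
  Covered : List ℕ → ℕ → Set
  Covered S x = x ∈ S ⊎ ∃[ c ] (Common DW DE c × ef DW c ≡ x × wf DW c ∈ S)

  Covers : List ℕ → List ℕ → Set
  Covers S ws = ∀ {x} → x ∈ ws → Covered S x

  covers-∷ : ∀ {S x ws} → Covered S x → Covers S ws → Covers S (x ∷ ws)
  covers-∷ c cs (here refl) = c
  covers-∷ c cs (there x∈)  = cs x∈

  data Segmentation (S : List ℕ) : ℕ → ℕ → Set where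
    nil  : ∀ {p} → Segmentation S p p
    cons : ∀ {p m q ws} X → SemiWalk (G X) p m ws → p ∈ ∂ X → m ∈ ∂ X →
           Covers S ws → Segmentation S m q → Segmentation S p q

  record Leading (S : List ℕ) (X : Side) (u q : ℕ) : Set where
    constructor leading
    field
      {m}     : ℕ
      {ws}    : List ℕ
      walk    : SemiWalk (G X) u m ws
      covered : Covers S ws
      m∈∂     : m ∈ ∂ X
      rest    : Segmentation S m q

  leading-segment : ∀ {S u q vs} → SemiWalk D u q vs → (∀ {x} → x ∈ vs → x ∈ S) → q ∈ ∂D →
    ∀ X → u ∈ verts (G X) → Leading S X u q
  leading-segment (here _) ⊆S q∈ X uX = leading (here uX) (covers-∷ (inj₁ (⊆S (here refl))) λ ()) (∂D→∂ X q∈ uX) nil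
  leading-segment {S} {u} {q} (step {w = w} {a = a} u∈D a∈D inc r) ⊆S q∈ Y uY with owner a∈D
  ... | own X aX ¬a′ = via-own X aX (own-incidence X a∈D aX ¬a′ inc)
    where
    via-own : ∀ X → a ∈ edges (G X) → Incident (G X) a u w → Leading S Y u q
    via-own X aX incX with same-part X Y (proj₁ (incident-verts (isGraph X) aX incX)) uY u∈D
    ... | refl =
      let leading walk covered m∈ rest = leading-segment r (λ x∈ → ⊆S (there x∈)) q∈ X (proj₂ (incident-verts (isGraph X) aX incX))
      in  leading (step uY aX incX walk) (covers-∷ (inj₁ (⊆S (here refl))) covered) m∈ rest
  ... | shared com = via-shared Y uY inc com
    where
    u-covered : Covered S u
    u-covered = inj₁ (⊆S (here refl))
    via-shared : ∀ Z → u ∈ verts (G Z) → Incident D a u w → Common DW DE a → Leading S Z u q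
    via-shared W uW (inj₁ (wu , ew)) com@(aW , aE) =
      let leading walk covered m∈ rest = leading-segment r (λ x∈ → ⊆S (there x∈)) q∈ E wE
      in  leading (step uW aW (inj₁ (wu′ , refl)) (here (IsGraph.e∈V (isGraph W) aW)))
                  (covers-∷ u-covered (covers-∷ j-covered λ ())) (junction-∂W com)
                  (cons E (step jE aE (inj₁ (sym jeq , ew′)) walk) (subst (_∈ ∂E) (sym jeq) (junction-∂E com))
                        m∈ (covers-∷ j-covered covered) rest)
      where
      jeq : ef DW a ≡ wf DE a
      jeq = proj₁ (common-edge com)
      wu′ : wf DW a ≡ u
      wu′ = trans (sym (wf-W a∈D aW)) wu
      ew′ : ef DE a ≡ w
      ew′ = trans (sym (ef-E a∈D aE)) ew
      wE : w ∈ verts DE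
      wE = subst (_∈ verts DE) ew′ (IsGraph.e∈V (isGraph E) aE)
      jE : ef DW a ∈ verts DE
      jE = subst (_∈ verts DE) (sym jeq) (IsGraph.w∈V (isGraph E) aE)
      j-covered : Covered S (ef DW a)
      j-covered = inj₂ (a , com , refl , subst (_∈ S) (sym wu′) (⊆S (here refl)))
    via-shared W uW (inj₂ (_ , eu)) (_ , aE) =
      ⊥-elim (shared-∉D uW (subst (_∈ verts DE) (trans (sym (ef-E a∈D aE)) eu) (IsGraph.e∈V (isGraph E) aE)) u∈D)
    via-shared E uE (inj₁ (wu , _)) (aW , _) =
      ⊥-elim (shared-∉D (subst (_∈ verts DW) (trans (sym (wf-W a∈D aW)) wu) (IsGraph.w∈V (isGraph W) aW)) uE u∈D)
    via-shared E uE (inj₂ (ww , eu)) com@(aW , aE) =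
      let leading walk covered m∈ rest = leading-segment r (λ x∈ → ⊆S (there x∈)) q∈ W wW
      in  leading (step uE aE (inj₂ (refl , eu′)) (here (IsGraph.w∈V (isGraph E) aE)))
                  (covers-∷ u-covered (covers-∷ j-covered λ ())) (junction-∂E com)
                  (cons W (step jW aW (inj₂ (ww′ , jeq)) walk) (subst (_∈ ∂W) jeq (junction-∂W com))
                        m∈ (covers-∷ j-covered covered) rest)
      where
      jeq : ef DW a ≡ wf DE a
      jeq = proj₁ (common-edge com)
      eu′ : ef DE a ≡ u
      eu′ = trans (sym (ef-E a∈D aE)) eu
      ww′ : wf DW a ≡ w
      ww′ = trans (sym (wf-W a∈D aW)) ww
      wW : w ∈ verts DW
      wW = subst (_∈ verts DW) ww′ (IsGraph.w∈V (isGraph W) aW)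
      jW : wf DE a ∈ verts DW
      jW = subst (_∈ verts DW) jeq (IsGraph.e∈V (isGraph W) aW)
      j-covered : Covered S (wf DE a)
      j-covered = inj₂ (a , com , jeq , subst (_∈ S) (sym ww′) (⊆S (there (source∈ r))))

  segmentation : ∀ {p q vs} → SemiWalk D p q vs → p ∈ ∂D → q ∈ ∂D → Segmentation vs p q
  segmentation {p} {q} {vs} P p∈ q∈ = [ start W , start E ]′ (D-verts (∂D-verts p∈))
    where
    start : ∀ X → p ∈ verts (G X) → Segmentation vs p q
    start X pX = let leading walk covered m∈ rest = leading-segment P (λ x∈ → x∈) q∈ X pX
                 in  cons X walk (∂D→∂ X p∈ pX) m∈ covered rest

  segmentSum : ∀ {S p q} → Side → (ℕ → Bool) → Segmentation S p q → Bool
  segmentSum X f nil = false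
  segmentSum W f (cons {p} {m} W _ _ _ _ rest) = (f p xor f m) xor segmentSum W f rest
  segmentSum E f (cons {p} {m} E _ _ _ _ rest) = (f p xor f m) xor segmentSum E f rest
  segmentSum W f (cons E _ _ _ _ rest) = segmentSum W f rest
  segmentSum E f (cons W _ _ _ _ rest) = segmentSum E f rest

  segmentSum-telescopes : ∀ {S p q} (f : ℕ → Bool) (ch : Segmentation S p q) →
    segmentSum W f ch xor segmentSum E f ch ≡ f p xor f q
  segmentSum-telescopes {p = p} f nil = sym (xor-same (f p))
  segmentSum-telescopes {p = p} {q} f (cons {m = m} W _ _ _ _ rest) =
    trans (xor-assoc (f p xor f m) (segmentSum W f rest) (segmentSum E f rest))
          (xor-telescope (f p) (f m) (f q) (segmentSum-telescopes f rest))
  segmentSum-telescopes {p = p} {q} f (cons {m = m} E _ _ _ _ rest) =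
    trans (x∙yz≈y∙xz (segmentSum W f rest) (f p xor f m) (segmentSum E f rest))
          (xor-telescope (f p) (f m) (f q) (segmentSum-telescopes f rest))

  segmentSum-shift : ∀ {S p q} X (f g : ℕ → Bool) κ (ch : Segmentation S p q) →
    (∀ a → a ∈ ∂ X → Covered S a → f a ≡ g a xor κ) → segmentSum X f ch ≡ segmentSum X g ch
  segmentSum-shift X f g κ nil H = refl
  segmentSum-shift W f g κ (cons {p} {m} W walk p∈ m∈ cov rest) H =
    cong₂ _xor_ (trans (cong₂ _xor_ (H p p∈ (cov (source∈ walk))) (H m m∈ (cov (target∈ walk)))) (xor-shift (g p) (g m) κ))
                (segmentSum-shift W f g κ rest H)
  segmentSum-shift E f g κ (cons {p} {m} E walk p∈ m∈ cov rest) H =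
    cong₂ _xor_ (trans (cong₂ _xor_ (H p p∈ (cov (source∈ walk))) (H m m∈ (cov (target∈ walk)))) (xor-shift (g p) (g m) κ))
                (segmentSum-shift E f g κ rest H)
  segmentSum-shift W f g κ (cons E _ _ _ _ rest) H = segmentSum-shift W f g κ rest H
  segmentSum-shift E f g κ (cons W _ _ _ _ rest) H = segmentSum-shift E f g κ rest H

  segmentSum-false : ∀ {S p q} X (ch : Segmentation S p q) → segmentSum X (λ _ → false) ch ≡ false
  segmentSum-false X nil = refl
  segmentSum-false W (cons W _ _ _ _ rest) = segmentSum-false W rest
  segmentSum-false W (cons E _ _ _ _ rest) = segmentSum-false W rest
  segmentSum-false E (cons W _ _ _ _ rest) = segmentSum-false E rest
  segmentSum-false E (cons E _ _ _ _ rest) = segmentSum-false E rest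

  segmentSum-constant : ∀ {S p q} X (f : ℕ → Bool) κ (ch : Segmentation S p q) →
    (∀ a → a ∈ ∂ X → Covered S a → f a ≡ κ) → segmentSum X f ch ≡ false
  segmentSum-constant X f κ ch H = trans (segmentSum-shift X f (λ _ → false) κ ch H) (segmentSum-false X ch)

  nonCrossing : ∀ X → NonCrossing (G X) (∂ X)
  nonCrossing W = subst (NonCrossing DW) ∂W-≡ ncW
  nonCrossing E = subst (NonCrossing DE) ∂E-≡ ncE

  segmentSum-stable : ∀ {SP SQ p q t t′ ws} Y → SemiWalk (G Y) t t′ ws → t ∈ ∂ Y → t′ ∈ ∂ Y → Covers SQ ws →
    (∀ {x} → Covered SP x → Covered SQ x → ⊥) → (ch : Segmentation SP p q) →
    segmentSum Y (λ a → before (∂ Y) a t) ch ≡ segmentSum Y (λ a → before (∂ Y) a t′) ch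
  segmentSum-stable Y Q t∈ t′∈ covQ disjoint nil = refl
  segmentSum-stable W Q t∈ t′∈ covQ disjoint (cons W P p∈ m∈ covP rest) =
    cong₂ _xor_ (nonCrossing W p∈ m∈ t∈ t′∈ P Q (λ (_ , xP , xQ) → disjoint (covP xP) (covQ xQ)))
                (segmentSum-stable W Q t∈ t′∈ covQ disjoint rest)
  segmentSum-stable E Q t∈ t′∈ covQ disjoint (cons E P p∈ m∈ covP rest) =
    cong₂ _xor_ (nonCrossing E p∈ m∈ t∈ t′∈ P Q (λ (_ , xP , xQ) → disjoint (covP xP) (covQ xQ)))
                (segmentSum-stable E Q t∈ t′∈ covQ disjoint rest)
  segmentSum-stable W Q t∈ t′∈ covQ disjoint (cons E _ _ _ _ rest) = segmentSum-stable W Q t∈ t′∈ covQ disjoint rest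
  segmentSum-stable E Q t∈ t′∈ covQ disjoint (cons W _ _ _ _ rest) = segmentSum-stable E Q t∈ t′∈ covQ disjoint rest

  -- Two common edges with the same juncture vertex coincide, by W-E-functionality of DW.
  covered-meet : ∀ {S₁ S₂ x} → (∀ {y} → y ∈ S₁ → y ∈ verts D) → (∀ {y} → y ∈ S₂ → y ∈ verts D) →
    Covered S₁ x → Covered S₂ x → Meet S₁ S₂
  covered-meet _ _ (inj₁ x∈₁) (inj₁ x∈₂) = _ , x∈₁ , x∈₂
  covered-meet {x = x} V₁ _ (inj₁ x∈₁) (inj₂ (c , com , refl , _)) =
    ⊥-elim (let x∈W , x∈E = from (shared⇔VC x) (c , com , refl) in shared-∉D x∈W x∈E (V₁ x∈₁))
  covered-meet {x = x} _ V₂ (inj₂ (c , com , refl , _)) (inj₁ x∈₂) =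
    ⊥-elim (let x∈W , x∈E = from (shared⇔VC x) (c , com , refl) in shared-∉D x∈W x∈E (V₂ x∈₂))
  covered-meet _ _ (inj₂ (c , com , refl , w∈₁)) (inj₂ (c′ , com′ , eq , w∈₂)) with c ≟ c′
  ... | yes refl = _ , w∈₁ , w∈₂
  ... | no c≢c′ = ⊥-elim (DGraph.functional gW E (proj₁ (proj₂ (common-edge com))) (proj₁ com′) (λ e → c≢c′ (sym e)) (sym eq))

  inΦW? inΦE? : ℕ → Bool
  inΦW? a = does (a ∈? ΦW)
  inΦE? a = does (a ∈? ΦE)

  onΞ : (ℕ → Bool) → (ℕ → Bool) → ℕ → Bool
  onΞ f g a = if does (a ∈? Ξ) then f a else g a

  onΞ-Ξ : ∀ f g {a} → a ∈ Ξ → onΞ f g a ≡ f a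
  onΞ-Ξ f g {a} a∈ = cong (if_then f a else g a) (dec-true (a ∈? Ξ) a∈)

  onΞ-∉Ξ : ∀ f g {a} → a ∉ Ξ → onΞ f g a ≡ g a
  onΞ-∉Ξ f g {a} a∉ = cong (if_then f a else g a) (dec-false (a ∈? Ξ) a∉)

  ∈ΦW : ∀ {a} → a ∈ ΦW → inΦW? a ≡ true
  ∈ΦW {a} = dec-true (a ∈? ΦW)
  ∉ΦW : ∀ {a} → a ∉ ΦW → inΦW? a ≡ false
  ∉ΦW {a} = dec-false (a ∈? ΦW)
  ∈ΦE : ∀ {a} → a ∈ ΦE → inΦE? a ≡ true
  ∈ΦE {a} = dec-true (a ∈? ΦE)
  ∉ΦE : ∀ {a} → a ∉ ΦE → inΦE? a ≡ false
  ∉ΦE {a} = dec-false (a ∈? ΦE)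

  WSide∉ΦW : ∀ {a} → WSide a → inΦW? a ≡ false
  WSide∉ΦW w = ∉ΦW (λ a∈ → WSide#ESide w (inΦW a∈))

  ESide∉ΦE : ∀ {a} → ESide a → inΦE? a ≡ false
  ESide∉ΦE e = ∉ΦE (λ a∈ → WSide#ESide (inΦE a∈) e)

  module Winding {SP p q} (chP : Segmentation SP p q) (p∈ : p ∈ ∂D) (q∈ : q ∈ ∂D) where

    ΣW ΣE : ℕ → Bool
    ΣW t = segmentSum W (λ a → before ∂W a t) chP
    ΣE t = segmentSum E (λ a → before ∂E a t) chP

    telescope-off-Ξ : ∀ f g → segmentSum W (onΞ f g) chP xor segmentSum E (onΞ f g) chP ≡ g p xor g q
    telescope-off-Ξ f g = trans (segmentSum-telescopes (onΞ f g) chP)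
                                (cong₂ _xor_ (onΞ-∉Ξ f g (off-Ξ p∈)) (onΞ-∉Ξ f g (off-Ξ q∈)))
      where
      off-Ξ : ∀ {x} → x ∈ ∂D → x ∉ Ξ
      off-Ξ x∈ x∈Ξ = Ξ-∉D x∈Ξ (∂D-verts x∈)

    ΣW-WSide : ∀ {t} → WSide t → ΣW t ≡ between ∂D p q t xor (inΦW? p xor inΦW? q)
    ΣW-WSide {t} t∈ = begin
      ΣW t                                        ≡⟨ segmentSum-shift W _ g false chP own-side ⟩
      segmentSum W g chP                          ≡⟨ xor-identityʳ _ ⟨
      segmentSum W g chP xor false                ≡⟨ cong (segmentSum W g chP xor_) (segmentSum-constant E g (inΦE? t) chP other-side) ⟨
      segmentSum W g chP xor segmentSum E g chP   ≡⟨ telescope-off-Ξ f₁ f₂ ⟩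
      (before ∂D p t xor inΦW? p) xor (before ∂D q t xor inΦW? q)  ≡⟨ interchange (before ∂D p t) (inΦW? p) (before ∂D q t) (inΦW? q) ⟩
      between ∂D p q t xor (inΦW? p xor inΦW? q)  ∎
      where
      open ≡-Reasoning
      f₁ f₂ g : ℕ → Bool
      f₁ a = before ∂W a t
      f₂ a = before ∂D a t xor inΦW? a
      g = onΞ f₁ f₂
      own-side : ∀ a → a ∈ ∂W → Covered SP a → before ∂W a t ≡ g a xor false
      own-side a a∈ _ with ∂W-view a∈
      ... | inj₂ a∈Ξ = trans (sym (onΞ-Ξ f₁ f₂ a∈Ξ)) (sym (xor-identityʳ _))
      ... | inj₁ w   = trans (∂W-agrees w t∈) (sym (begin
        g a xor false                  ≡⟨ xor-identityʳ _ ⟩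
        g a                            ≡⟨ onΞ-∉Ξ f₁ f₂ (WSide#Ξ w) ⟩
        before ∂D a t xor inΦW? a      ≡⟨ cong (before ∂D a t xor_) (WSide∉ΦW w) ⟩
        before ∂D a t xor false        ≡⟨ xor-identityʳ _ ⟩
        before ∂D a t                  ∎))
      on-Ξ : ∀ {a} → a ∈ Ξ → WSide t → before ∂W a t ≡ inΦE? t
      on-Ξ x (inLWW y) = trans (after-++ Unique-∂W LWW<Ξʳ y (Any.reverse⁺ x)) (sym (∉ΦE (LWW#ΦE y)))
      on-Ξ x (inΨE y)  = trans (after-++ Unique-∂W ΨEʳ<Ξʳ (Any.reverse⁺ y) (Any.reverse⁺ x)) (sym (∉ΦE (ΨE#ΦE y)))
      on-Ξ x (inΦE y)  = trans (before-++ Unique-∂W Ξʳ<ΦEʳ (Any.reverse⁺ x) (Any.reverse⁺ y)) (sym (∈ΦE y))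
      off-Ξ : ∀ {a} → ESide a → WSide t → before ∂D a t xor inΦW? a ≡ inΦE? t
      off-Ξ (inΦW x)  (inLWW y) = trans (cong₂ _xor_ (before-++ Unique-∂D ΦW<LWW x y) (∈ΦW x)) (sym (∉ΦE (LWW#ΦE y)))
      off-Ξ (inΦW x)  (inΨE y)  = trans (cong₂ _xor_ (before-++ Unique-∂D ΦW<ΨEʳ x (Any.reverse⁺ y)) (∈ΦW x)) (sym (∉ΦE (ΨE#ΦE y)))
      off-Ξ (inΦW x)  (inΦE y)  = ⊥-elim (not-both-Φ y x)
      off-Ξ (inΨW x)  (inLWW y) = trans (cong₂ _xor_ (after-++ Unique-∂D LWW<ΨW y x) (∉ΦW (ΨW#ΦW x))) (sym (∉ΦE (LWW#ΦE y)))
      off-Ξ (inΨW x)  (inΨE y)  = ⊥-elim (not-both-Ψ y x)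
      off-Ξ (inΨW x)  (inΦE y)  = trans (cong₂ _xor_ (before-++ Unique-∂D ΨW<ΦEʳ x (Any.reverse⁺ y)) (∉ΦW (ΨW#ΦW x))) (sym (∈ΦE y))
      off-Ξ (inLEE x) (inLWW y) = trans (cong₂ _xor_ (after-++ Unique-∂D LWW<LEEʳ y (Any.reverse⁺ x)) (∉ΦW (LEE#ΦW x))) (sym (∉ΦE (LWW#ΦE y)))
      off-Ξ (inLEE x) (inΨE y)  = trans (cong₂ _xor_ (after-++ Unique-∂D ΨEʳ<LEEʳ (Any.reverse⁺ y) (Any.reverse⁺ x)) (∉ΦW (LEE#ΦW x))) (sym (∉ΦE (ΨE#ΦE y)))
      off-Ξ (inLEE x) (inΦE y)  = trans (cong₂ _xor_ (before-++ Unique-∂D LEEʳ<ΦEʳ (Any.reverse⁺ x) (Any.reverse⁺ y)) (∉ΦW (LEE#ΦW x))) (sym (∈ΦE y))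
      other-side : ∀ a → a ∈ ∂E → Covered SP a → g a ≡ inΦE? t
      other-side a a∈ _ with ∂E-view a∈
      ... | inj₂ a∈Ξ = trans (onΞ-Ξ f₁ f₂ a∈Ξ) (on-Ξ a∈Ξ t∈)
      ... | inj₁ e   = trans (onΞ-∉Ξ f₁ f₂ (ESide#Ξ e)) (off-Ξ e t∈)

    ΣE-ESide : ∀ {t} → ESide t → ΣE t ≡ between ∂D p q t xor (inΦE? p xor inΦE? q)
    ΣE-ESide {t} t∈ = begin
      ΣE t                                        ≡⟨ segmentSum-shift E _ g false chP own-side ⟩
      false xor segmentSum E g chP                ≡⟨ cong (_xor segmentSum E g chP) (segmentSum-constant W g (not (inΦW? t)) chP other-side) ⟨
      segmentSum W g chP xor segmentSum E g chP   ≡⟨ telescope-off-Ξ f₁ f₂ ⟩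
      (before ∂D p t xor inΦE? p) xor (before ∂D q t xor inΦE? q)  ≡⟨ interchange (before ∂D p t) (inΦE? p) (before ∂D q t) (inΦE? q) ⟩
      between ∂D p q t xor (inΦE? p xor inΦE? q)  ∎
      where
      open ≡-Reasoning
      f₁ f₂ g : ℕ → Bool
      f₁ a = before ∂E a t
      f₂ a = before ∂D a t xor inΦE? a
      g = onΞ f₁ f₂
      own-side : ∀ a → a ∈ ∂E → Covered SP a → before ∂E a t ≡ g a xor false
      own-side a a∈ _ with ∂E-view a∈
      ... | inj₂ a∈Ξ = trans (sym (onΞ-Ξ f₁ f₂ a∈Ξ)) (sym (xor-identityʳ _))
      ... | inj₁ e   = trans (∂E-agrees e t∈) (sym (begin
        g a xor false                  ≡⟨ xor-identityʳ _ ⟩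
        g a                            ≡⟨ onΞ-∉Ξ f₁ f₂ (ESide#Ξ e) ⟩
        before ∂D a t xor inΦE? a      ≡⟨ cong (before ∂D a t xor_) (ESide∉ΦE e) ⟩
        before ∂D a t xor false        ≡⟨ xor-identityʳ _ ⟩
        before ∂D a t                  ∎))
      on-Ξ : ∀ {a} → a ∈ Ξ → ESide t → before ∂E a t ≡ not (inΦW? t)
      on-Ξ x (inΦW y)  = trans (after-++ Unique-∂E ΦW<Ξ y x) (sym (cong not (∈ΦW y)))
      on-Ξ x (inΨW y)  = trans (before-++ Unique-∂E Ξ<ΨW x y) (sym (cong not (∉ΦW (ΨW#ΦW y))))
      on-Ξ x (inLEE y) = trans (before-++ Unique-∂E Ξ<LEEʳ x (Any.reverse⁺ y)) (sym (cong not (∉ΦW (LEE#ΦW y))))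
      off-Ξ : ∀ {a} → WSide a → ESide t → before ∂D a t xor inΦE? a ≡ not (inΦW? t)
      off-Ξ (inLWW x) (inΦW y)  = trans (cong₂ _xor_ (after-++ Unique-∂D ΦW<LWW y x) (∉ΦE (LWW#ΦE x))) (sym (cong not (∈ΦW y)))
      off-Ξ (inLWW x) (inΨW y)  = trans (cong₂ _xor_ (before-++ Unique-∂D LWW<ΨW x y) (∉ΦE (LWW#ΦE x))) (sym (cong not (∉ΦW (ΨW#ΦW y))))
      off-Ξ (inLWW x) (inLEE y) = trans (cong₂ _xor_ (before-++ Unique-∂D LWW<LEEʳ x (Any.reverse⁺ y)) (∉ΦE (LWW#ΦE x))) (sym (cong not (∉ΦW (LEE#ΦW y))))
      off-Ξ (inΨE x)  (inΦW y)  = trans (cong₂ _xor_ (after-++ Unique-∂D ΦW<ΨEʳ y (Any.reverse⁺ x)) (∉ΦE (ΨE#ΦE x))) (sym (cong not (∈ΦW y)))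
      off-Ξ (inΨE x)  (inΨW y)  = ⊥-elim (not-both-Ψ x y)
      off-Ξ (inΨE x)  (inLEE y) = trans (cong₂ _xor_ (before-++ Unique-∂D ΨEʳ<LEEʳ (Any.reverse⁺ x) (Any.reverse⁺ y)) (∉ΦE (ΨE#ΦE x))) (sym (cong not (∉ΦW (LEE#ΦW y))))
      off-Ξ (inΦE x)  (inΦW y)  = ⊥-elim (not-both-Φ x y)
      off-Ξ (inΦE x)  (inΨW y)  = trans (cong₂ _xor_ (after-++ Unique-∂D ΨW<ΦEʳ y (Any.reverse⁺ x)) (∈ΦE x)) (sym (cong not (∉ΦW (ΨW#ΦW y))))
      off-Ξ (inΦE x)  (inLEE y) = trans (cong₂ _xor_ (after-++ Unique-∂D LEEʳ<ΦEʳ (Any.reverse⁺ y) (Any.reverse⁺ x)) (∈ΦE x)) (sym (cong not (∉ΦW (LEE#ΦW y))))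
      other-side : ∀ a → a ∈ ∂W → Covered SP a → g a ≡ not (inΦW? t)
      other-side a a∈ _ with ∂W-view a∈
      ... | inj₂ a∈Ξ = trans (onΞ-Ξ f₁ f₂ a∈Ξ) (on-Ξ a∈Ξ t∈)
      ... | inj₁ w   = trans (onΞ-∉Ξ f₁ f₂ (WSide#Ξ w)) (off-Ξ w t∈)

    K : Bool
    K = (inΦW? p xor inΦE? p) xor (inΦW? q xor inΦE? q)

    ΣW-Ξ : ∀ {t} → t ∈ Ξ → (∀ {a} → Covered SP a → a ≢ t) → ΣW t ≡ ΣE t xor K
    ΣW-Ξ {t} t∈ avoids = xor-transpose (begin
      ΣW t xor ΣE t                               ≡⟨ cong₂ _xor_ (segmentSum-shift W _ h false chP W-side) (segmentSum-shift E _ h true chP E-side) ⟩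
      segmentSum W h chP xor segmentSum E h chP   ≡⟨ telescope-off-Ξ f₁ f₂ ⟩
      f₂ p xor f₂ q                               ≡⟨ xor-annihilates-not (inΦW? p xor inΦE? p) (inΦW? q xor inΦE? q) ⟩
      K                                           ∎)
      where
      open ≡-Reasoning
      f₁ f₂ h : ℕ → Bool
      f₁ a = before ∂W a t
      f₂ a = not (inΦW? a xor inΦE? a)
      h = onΞ f₁ f₂
      off-W : ∀ {a} → WSide a → before ∂W a t ≡ f₂ a
      off-W (inLWW x) = trans (before-++ Unique-∂W LWW<Ξʳ x (Any.reverse⁺ t∈)) (sym (cong not (cong₂ _xor_ (WSide∉ΦW (inLWW x)) (∉ΦE (LWW#ΦE x)))))
      off-W (inΨE x)  = trans (before-++ Unique-∂W ΨEʳ<Ξʳ (Any.reverse⁺ x) (Any.reverse⁺ t∈)) (sym (cong not (cong₂ _xor_ (WSide∉ΦW (inΨE x)) (∉ΦE (ΨE#ΦE x)))))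
      off-W (inΦE x)  = trans (after-++ Unique-∂W Ξʳ<ΦEʳ (Any.reverse⁺ t∈) (Any.reverse⁺ x)) (sym (cong not (cong₂ _xor_ (WSide∉ΦW (inΦE x)) (∈ΦE x))))
      W-side : ∀ a → a ∈ ∂W → Covered SP a → before ∂W a t ≡ h a xor false
      W-side a a∈ _ with ∂W-view a∈
      ... | inj₂ a∈Ξ = trans (sym (onΞ-Ξ f₁ f₂ a∈Ξ)) (sym (xor-identityʳ _))
      ... | inj₁ w   = trans (off-W w) (sym (trans (xor-identityʳ _) (onΞ-∉Ξ f₁ f₂ (WSide#Ξ w))))
      off-E : ∀ {a} → ESide a → before ∂E a t ≡ f₂ a xor true
      off-E (inΦW x)  = trans (before-++ Unique-∂E ΦW<Ξ x t∈) (sym (cong (λ b → not b xor true) (cong₂ _xor_ (∈ΦW x) (ESide∉ΦE (inΦW x)))))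
      off-E (inΨW x)  = trans (after-++ Unique-∂E Ξ<ΨW t∈ x) (sym (cong (λ b → not b xor true) (cong₂ _xor_ (∉ΦW (ΨW#ΦW x)) (ESide∉ΦE (inΨW x)))))
      off-E (inLEE x) = trans (after-++ Unique-∂E Ξ<LEEʳ t∈ (Any.reverse⁺ x)) (sym (cong (λ b → not b xor true) (cong₂ _xor_ (∉ΦW (LEE#ΦW x)) (ESide∉ΦE (inLEE x)))))
      -- Ξ runs through ∂W and ∂E in opposite directions.
      on-Ξ : ∀ {a} → a ∈ Ξ → a ≢ t → before ∂E a t ≡ before ∂W a t xor true
      on-Ξ a∈ a≢t with precedes-or-follows a∈ t∈ a≢t
      ... | inj₁ a<t = trans (before-true Unique-∂E (⊆-trans a<t Ξ⊆∂E))
                             (sym (cong (_xor true) (before-false Unique-∂W (⊆-trans (Sublist.reverse⁺ a<t) Ξʳ⊆∂W))))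
      ... | inj₂ t<a = trans (before-false Unique-∂E (⊆-trans t<a Ξ⊆∂E))
                             (sym (cong (_xor true) (before-true Unique-∂W (⊆-trans (Sublist.reverse⁺ t<a) Ξʳ⊆∂W))))
      E-side : ∀ a → a ∈ ∂E → Covered SP a → before ∂E a t ≡ h a xor true
      E-side a a∈ covered with ∂E-view a∈
      ... | inj₂ a∈Ξ = trans (on-Ξ a∈Ξ (avoids covered)) (sym (cong (_xor true) (onΞ-Ξ f₁ f₂ a∈Ξ)))
      ... | inj₁ e   = trans (off-E e) (sym (cong (_xor true) (onΞ-∉Ξ f₁ f₂ (ESide#Ξ e))))

    -- τ t records on which side of P the boundary vertex t lies.
    τ : ℕ → Bool
    τ t = if does (t ∈? ∂W) then ΣW t else ΣE t xor K

    τ-∂W : ∀ {t} → t ∈ ∂W → τ t ≡ ΣW t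
    τ-∂W {t} t∈ = cong (if_then ΣW t else ΣE t xor K) (dec-true (t ∈? ∂W) t∈)

    τ-∉∂W : ∀ {t} → t ∉ ∂W → τ t ≡ ΣE t xor K
    τ-∉∂W {t} t∉ = cong (if_then ΣW t else ΣE t xor K) (dec-false (t ∈? ∂W) t∉)

    τ-∂E : ∀ {t} → t ∈ ∂E → (∀ {a} → Covered SP a → a ≢ t) → τ t ≡ ΣE t xor K
    τ-∂E {t} t∈ avoids = by-cases (t ∈? ∂W)
      where
      by-cases : Dec (t ∈ ∂W) → τ t ≡ ΣE t xor K
      by-cases (yes t∈W) = trans (τ-∂W t∈W) (ΣW-Ξ (∂W∩∂E⊆Ξ t∈W t∈) avoids)
      by-cases (no t∉W)  = τ-∉∂W t∉W

    τ-∂D : ∀ {t} → t ∈ ∂D → τ t ≡ between ∂D p q t xor (inΦW? p xor inΦW? q)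
    τ-∂D {t} t∈ with ∂D-view t∈
    ... | inj₁ w = trans (τ-∂W (WSide-∂W w)) (ΣW-WSide w)
    ... | inj₂ e = trans (τ-∉∂W (not-in-∂W e)) (trans (cong (_xor K) (ΣE-ESide e)) (rebase (between ∂D p q t) (inΦW? p) (inΦE? p) (inΦW? q) (inΦE? q)))
      where
      not-in-∂W : ∀ {x} → ESide x → x ∉ ∂W
      not-in-∂W e x∈ = [ (λ w → WSide#ESide w e) , ESide#Ξ e ]′ (∂W-view x∈)
      rebase : ∀ s wp ep wq eq → (s xor (ep xor eq)) xor ((wp xor ep) xor (wq xor eq)) ≡ s xor (wp xor wq)
      rebase s wp ep wq eq = trans (cong ((s xor (ep xor eq)) xor_) (interchange wp ep wq eq)) (xor-shift s (wp xor wq) (ep xor eq))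

    τ-constant : ∀ {SQ c d} → Segmentation SQ c d → (∀ {x} → Covered SP x → Covered SQ x → ⊥) → τ c ≡ τ d
    τ-constant nil _ = refl
    τ-constant {SQ} (cons {c} {m} W Q c∈ m∈ cov rest) disjoint = begin
      τ c   ≡⟨ τ-∂W c∈ ⟩
      ΣW c  ≡⟨ segmentSum-stable W Q c∈ m∈ cov disjoint chP ⟩
      ΣW m  ≡⟨ τ-∂W m∈ ⟨
      τ m   ≡⟨ τ-constant rest disjoint ⟩
      _     ∎
      where open ≡-Reasoning
    τ-constant {SQ} (cons {c} {m} E Q c∈ m∈ cov rest) disjoint = begin
      τ c          ≡⟨ τ-∂E c∈ (avoids (cov (source∈ Q))) ⟩
      ΣE c xor K   ≡⟨ cong (_xor K) (segmentSum-stable E Q c∈ m∈ cov disjoint chP) ⟩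
      ΣE m xor K   ≡⟨ τ-∂E m∈ (avoids (cov (target∈ Q))) ⟨
      τ m          ≡⟨ τ-constant rest disjoint ⟩
      _            ∎
      where
      open ≡-Reasoning
      avoids : ∀ {x} → Covered SQ x → ∀ {a} → Covered SP a → a ≢ x
      avoids cx ca refl = disjoint ca cx

  juncture-nonCrossing : NonCrossing D ((ΦW ++ LWW ++ ΨW) ++ reverse (ΦE ++ LEE ++ ΨE))
  juncture-nonCrossing = subst (NonCrossing D) (sym ∂D-≡) nonCrossing-∂D
    where
    nonCrossing-∂D : NonCrossing D ∂D
    nonCrossing-∂D {a} {b} {c} {d} a∈ b∈ c∈ d∈ P Q ¬meet = xor-injectiveʳ (inΦW? a xor inΦW? b) (begin
      between ∂D a b c xor (inΦW? a xor inΦW? b)  ≡⟨ τ-∂D c∈ ⟨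
      τ c                                         ≡⟨ τ-constant (segmentation Q c∈ d∈) disjoint ⟩
      τ d                                         ≡⟨ τ-∂D d∈ ⟩
      between ∂D a b d xor (inΦW? a xor inΦW? b)  ∎)
      where
      open ≡-Reasoning
      open Winding (segmentation P a∈ b∈) a∈ b∈
      disjoint : ∀ {x} → Covered _ x → Covered _ x → ⊥
      disjoint cP cQ = ¬meet (covered-meet (walk-verts P) (walk-verts Q) cP cQ)

root : ∀ {D LW LE} → Construction D LW LE → DGraph D × XList W D LW × XList E D LE
root (leaf g _ xW xE)                 = g , xW , xE
root (node _ _ _ _ _ _ _ g xW xE)     = g , xW , xE

construction-nonCrossing : ∀ {D LW LE} → Construction D LW LE → NonCrossing D (LW ++ reverse LE)
construction-nonCrossing (leaf g basic xW xE) = basic-nonCrossing g basic xW xE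
construction-nonCrossing (node kW kE jd ij refl refl compatible gD xDW xDE) =
  let gW , xWW , xWE = root kW
      gE , xEW , xEE = root kE
  in  Juncture.juncture-nonCrossing gW gE gD jd ij xWW xWE xEW xEE xDW xDE compatible
        (construction-nonCrossing kW) (construction-nonCrossing kE)

between-inside : ∀ {L a t b} → Unique L → (a ∷ t ∷ b ∷ []) ⊆ L → between L a b t ≡ true
between-inside u τ = cong₂ _xor_ (before-true u (⊆-trans (refl ∷ refl ∷ _ ∷ʳ []) τ))
                                 (before-false u (⊆-trans (_ ∷ʳ refl ∷ refl ∷ []) τ))

between-outside : ∀ {L a b u} → Unique L → (a ∷ b ∷ u ∷ []) ⊆ L ⊎ (u ∷ a ∷ b ∷ []) ⊆ L → between L a b u ≡ false
between-outside u (inj₁ τ) = cong₂ _xor_ (before-true u (⊆-trans (refl ∷ _ ∷ʳ refl ∷ []) τ))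
                                         (before-true u (⊆-trans (_ ∷ʳ refl ∷ refl ∷ []) τ))
between-outside u (inj₂ τ) = cong₂ _xor_ (before-false u (⊆-trans (refl ∷ refl ∷ _ ∷ʳ []) τ))
                                         (before-false u (⊆-trans (refl ∷ _ ∷ʳ refl ∷ []) τ))

separated⇒cross : ∀ {D L a b c d} → NonCrossing D L → a ∈ L → b ∈ L → c ∈ L → d ∈ L →
  between L a b c ≢ between L a b d → Cross D a b c d
separated⇒cross nc a∈ b∈ c∈ d∈ separated {vs} {ws} (P , _) (Q , _) with meet? vs ws
... | yes meet = meet
... | no ¬meet = ⊥-elim (separated (nc a∈ b∈ c∈ d∈ P Q ¬meet))

chord-cross : ∀ {D L a b c d} → NonCrossing D L → Unique L → (a ∷ c ∷ b ∷ []) ⊆ L →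
  (a ∷ b ∷ d ∷ []) ⊆ L ⊎ (d ∷ a ∷ b ∷ []) ⊆ L → Cross D a b c d × Cross D b a c d
chord-cross {L = L} {a} {b} {c} {d} nc u τ σ =
    separated⇒cross nc a∈ b∈ c∈ d∈ (λ eq → true≢false (trans (sym inside) (trans eq outside)))
  , separated⇒cross nc b∈ a∈ c∈ d∈ (λ eq → true≢false
      (trans (sym inside) (trans (between-comm L a b c) (trans eq (trans (between-comm L b a d) outside)))))
  where
  inside : between L a b c ≡ true
  inside = between-inside u τ
  outside : between L a b d ≡ false
  outside = between-outside u σ
  a∈ : a ∈ L
  a∈ = lookup τ (here refl)
  c∈ : c ∈ L
  c∈ = lookup τ (there (here refl))
  b∈ : b ∈ L
  b∈ = lookup τ (there (there (here refl)))
  d∈ : d ∈ L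
  d∈ = [ (λ σ′ → lookup σ′ (there (there (here refl)))) , (λ σ′ → lookup σ′ (here refl)) ]′ σ

interleaved-cross : ∀ {D L q₁ q₂ q₃ q₄} → NonCrossing D L → Unique L → (q₁ ∷ q₂ ∷ q₃ ∷ q₄ ∷ []) ⊆ L →
  (Cross D q₁ q₃ q₂ q₄ × Cross D q₃ q₁ q₂ q₄) × (Cross D q₂ q₄ q₃ q₁ × Cross D q₄ q₂ q₃ q₁)
interleaved-cross nc u τ =
    chord-cross nc u (⊆-trans (refl ∷ refl ∷ refl ∷ _ ∷ʳ []) τ) (inj₁ (⊆-trans (refl ∷ _ ∷ʳ refl ∷ refl ∷ []) τ))
  , chord-cross nc u (⊆-trans (_ ∷ʳ refl ∷ refl ∷ refl ∷ []) τ) (inj₂ (⊆-trans (refl ∷ refl ∷ _ ∷ʳ refl ∷ []) τ))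

nonCrossing-consequences : ∀ {D LW LE} → DGraph D → XList W D LW → XList E D LE →
  NonCrossing D (LW ++ reverse LE) →
    (∀ x y z u → Precedes x y LW → Precedes z u LE → Cross D x u y z) ×
    (∀ X x y z → Chain (sel X LW LE) (x ∷ y ∷ z ∷ []) → Psi X D x y z) ×
    (∀ X x y u z → Chain (sel X LW LE) (x ∷ y ∷ u ∷ z ∷ []) → Cross D x u y z)
nonCrossing-consequences {D} {LW} {LE} g xW xE nc = part₁ , part₂ , part₃
  where
  cross : ∀ {q₁ q₂ q₃ q₄} → (q₁ ∷ q₂ ∷ q₃ ∷ q₄ ∷ []) ⊆ LW ++ reverse LE →
    (Cross D q₁ q₃ q₂ q₄ × Cross D q₃ q₁ q₂ q₄) × (Cross D q₂ q₄ q₃ q₁ × Cross D q₄ q₂ q₃ q₁)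
  cross = interleaved-cross nc (Unique-boundary g xW xE)
  part₁ : ∀ x y z u → Precedes x y LW → Precedes z u LE → Cross D x u y z
  part₁ _ _ _ _ τ σ = proj₁ (proj₁ (cross (Sublist.++⁺ τ (Sublist.reverse⁺ σ))))
  part₂ : ∀ X x y z → Chain (sel X LW LE) (x ∷ y ∷ z ∷ []) → Psi X D x y z
  part₂ W _ _ _ (inj₁ τ) t xt = proj₁ (proj₁ (cross (Sublist.++⁺ τ (from∈ (Any.reverse⁺ (from (proj₂ xE t) xt))))))
  part₂ W _ _ _ (inj₂ τ) t xt = proj₂ (proj₁ (cross (Sublist.++⁺ τ (from∈ (Any.reverse⁺ (from (proj₂ xE t) xt))))))
  part₂ E _ _ _ (inj₁ τ) t xt = proj₂ (proj₂ (cross (Sublist.++⁺ (from∈ (from (proj₂ xW t) xt)) (Sublist.reverse⁺ τ))))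
  part₂ E _ _ _ (inj₂ τ) t xt = proj₁ (proj₂ (cross (Sublist.++⁺ (from∈ (from (proj₂ xW t) xt)) (Sublist.reverse⁺ τ))))
  part₃ : ∀ X x y u z → Chain (sel X LW LE) (x ∷ y ∷ u ∷ z ∷ []) → Cross D x u y z
  part₃ W _ _ _ _ (inj₁ τ) = proj₁ (proj₁ (cross (Sublist.++⁺ʳ (reverse LE) τ)))
  part₃ W _ _ _ _ (inj₂ τ) = proj₂ (proj₂ (cross (Sublist.++⁺ʳ (reverse LE) τ)))
  part₃ E _ _ _ _ (inj₁ τ) = proj₂ (proj₂ (cross (Sublist.++⁺ˡ LW (Sublist.reverse⁺ τ))))
  part₃ E _ _ _ _ (inj₂ τ) = proj₁ (proj₁ (cross (Sublist.++⁺ˡ LW (Sublist.reverse⁺ τ))))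

proposition2p2p1 : ∀ {D LW LE} → Construction D LW LE →
    (∀ x y z u → Precedes x y LW → Precedes z u LE → Cross D x u y z) ×
    (∀ X x y z → Chain (sel X LW LE) (x ∷ y ∷ z ∷ []) → Psi X D x y z) ×
    (∀ X x y u z → Chain (sel X LW LE) (x ∷ y ∷ u ∷ z ∷ []) → Cross D x u y z)
proposition2p2p1 K = let g , xW , xE = root K in nonCrossing-consequences g xW xE (construction-nonCrossing K)
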